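{- Let $G$ be a graph on $[n]$. Then (i) $m_{\le1}(\mathrm{GIN}(G))=n$; (ii) $m_{\le k}(\Delta^s(G))=m_{\le k+1}(\mathrm{GIN}(G))-n$ for all $k=1,2,\dots,n-1$.
   Context: Let $K$ be a field of characteristic $0$, $R=K[x_1,\dots,x_n]$, $\prec_{rev}$ the degree reverse lexicographic order with $x_1\prec\cdots\prec x_n$ (lower degree smaller; for equal degree, $x^a\prec_{rev}x^b$ iff the leftmost nonzero entry of $b-a$ is negative). $g=(a_{ij})\in GL_n(K)$ acts by $x_j\mapsto\sum_i a_{ij}x_i$; $\mathrm{gin}(I)=\mathrm{in}_{\prec_{rev}}(g(I))$ for $g$ in a nonempty Zariski open set on which it is constant. $I_G$ is generated by $x_ix_j$ ($i\ne j$, $\{i,j\}\notin E(G)$) and all squarefree monomials of degree $3$. $\mathrm{GIN}(G)$ is the set of degree-2 monomials $x_ix_j$ ($1\le i\le j\le n$) not in $\mathrm{gin}(I_G)$, and $m_{\le k}(\mathrm{GIN}(G))=|\{x_ix_j\in\mathrm{GIN}(G):\min\{i,j\}\le k\}|$. $\Delta^s(G)$ is the graph on $[n]$ with edges $\{i-1,j\}$ for $2\le i\le j\le n$ with $x_ix_j\in\mathrm{GIN}(G)$. For a graph $H$, $m_{\le k}(H)$ is the number of edges $\{i,j\}$ of $H$ with $\min\{i,j\}\le k$. -}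

module Defs where

open import Level using (Level; _⊔_)
open import Data.Nat as ℕ using (ℕ; zero; suc; _<_; _≤_; _∸_) renaming (_+_ to _+ℕ_)
open import Data.Bool using (Bool; true; false; if_then_else_)
open import Data.Fin as Fin using (Fin; toℕ; remQuot)
open import Data.Fin.Properties using () renaming (_≟_ to _≟ᶠ_)
open import Data.Vec as Vec using (Vec; []; _∷_; lookup; tabulate; zipWith; replicate)
open import Data.Vec.Properties using (≡-dec)
open import Data.List as List using (List; []; _∷_; _++_; map; concatMap; allFin)
open import Data.List.Relation.Unary.All using (All)
open import Data.List.Relation.Unary.Any using (Any)
open import Data.Product using (Σ; _×_; _,_; proj₁; proj₂; ∃)
open import Data.Sum using (_⊎_)
open import Relation.Nullary using (¬_; yes; no; does)
open import Relation.Binary.PropositionalEquality using (_≡_)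
open import Algebra.Bundles using (CommutativeRing)
open import Function.Bundles using (_⇔_)

record Field (c ℓ : Level) : Set (Level.suc (c ⊔ ℓ)) where
  field
    commutativeRing : CommutativeRing c ℓ
  open CommutativeRing commutativeRing public
  field
    1≉0     : ¬ (1# ≈ 0#)
    inverse : ∀ x → ¬ (x ≈ 0#) → Σ Carrier λ y → (x * y) ≈ 1#

module _ {c ℓ : Level} (K : Field c ℓ) where
  open Field K

  natK : ℕ → Carrier
  natK zero    = 0#
  natK (suc k) = 1# + natK k

  CharZero : Set ℓ
  CharZero = ∀ k → ¬ (natK (suc k) ≈ 0#)

  powK : Carrier → ℕ → Carrier
  powK x zero    = 1#
  powK x (suc k) = x * powK x k

  sumF : ∀ {m} → (Fin m → Carrier) → Carrier
  sumF {zero}  f = 0#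
  sumF {suc m} f = f Fin.zero + sumF (λ i → f (Fin.suc i))

  -- Polynomials in K[x_1..x_m]: formal finite sums of terms c·x^a,
  -- a ∈ ℕ^m (index Fin.zero is the variable x_1).  Equality is equality
  -- of all coefficients.

  Mon : ℕ → Set
  Mon m = Vec ℕ m

  Poly : ℕ → Set c
  Poly m = List (Carrier × Mon m)

  coeff : ∀ {m} → Poly m → Mon m → Carrier
  coeff []             b = 0#
  coeff ((x , a) ∷ p) b with ≡-dec ℕ._≟_ a b
  ... | yes _ = x + coeff p b
  ... | no  _ = coeff p b

  _≃_ : ∀ {m} → Poly m → Poly m → Set ℓ
  p ≃ q = ∀ b → coeff p b ≈ coeff q b

  _⊕_ : ∀ {m} → Poly m → Poly m → Poly m
  p ⊕ q = p ++ q

  _⊗_ : ∀ {m} → Poly m → Poly m → Poly m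
  p ⊗ q = concatMap (λ t → map (λ u → (proj₁ t * proj₁ u , zipWith _+ℕ_ (proj₂ t) (proj₂ u))) q) p

  zeroP : ∀ {m} → Poly m
  zeroP = []

  oneP : ∀ {m} → Poly m
  oneP = (1# , replicate _ 0) ∷ []

  unitMon : ∀ {m} → Fin m → Mon m
  unitMon i = tabulate (λ j → if does (i ≟ᶠ j) then 1 else 0)

  var : ∀ {m} → Fin m → Poly m
  var i = (1# , unitMon i) ∷ []

  powP : ∀ {m} → Poly m → ℕ → Poly m
  powP p zero    = oneP
  powP p (suc k) = p ⊗ powP p k

  sumP : ∀ {m} → List (Poly m) → Poly m
  sumP = List.foldr _⊕_ zeroP

  evalMon : ∀ {m} → Mon m → Vec Carrier m → Carrier
  evalMon []      []      = 1#
  evalMon (a ∷ as) (x ∷ xs) = powK x a * evalMon as xs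

  eval : ∀ {m} → Poly m → Vec Carrier m → Carrier
  eval []             v = 0#
  eval ((x , a) ∷ p) v = x * evalMon a v + eval p v

  Matrix : ℕ → Set c
  Matrix n = Fin n → Fin n → Carrier

  _·M_ : ∀ {n} → Matrix n → Matrix n → Matrix n
  (g ·M h) i k = sumF (λ j → g i j * h j k)

  idM : ∀ {n} → Matrix n
  idM i j = if does (i ≟ᶠ j) then 1# else 0#

  InGL : ∀ {n} → Matrix n → Set (c ⊔ ℓ)
  InGL {n} g = Σ (Matrix n) λ h → ∀ i j → (g ·M h) i j ≈ idM i j

  substMon : ∀ {m k} → (Fin m → Poly k) → Mon m → Poly k
  substMon {zero}  L []       = oneP
  substMon {suc m} L (a ∷ as) = powP (L Fin.zero) a ⊗ substMon (λ j → L (Fin.suc j)) as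

  substP : ∀ {m k} → (Fin m → Poly k) → Poly m → Poly k
  substP L []             = []
  substP L ((x , a) ∷ p) = (((x , replicate _ 0) ∷ []) ⊗ substMon L a) ++ substP L p

  act : ∀ {n} → Matrix n → Poly n → Poly n
  act {n} g = substP (λ j → map (λ i → (g i j , unitMon i)) (allFin n))

  flatten : ∀ {n} → Matrix n → Vec Carrier (n ℕ.* n)
  flatten {n} g = tabulate (λ k → let ij = remQuot n k in g (proj₁ ij) (proj₂ ij))

  -- Zariski open subset of GL_n: complement in GL_n of the common zero
  -- set of a finite list of polynomials in the n² matrix entries.
  InOpen : ∀ {n} → List (Poly (n ℕ.* n)) → Matrix n → Set (c ⊔ ℓ)
  InOpen Ps g = InGL g × Any (λ P → ¬ (eval P (flatten g) ≈ 0#)) Ps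

  NonemptyOpen : ∀ {n} → List (Poly (n ℕ.* n)) → Set (c ⊔ ℓ)
  NonemptyOpen {n} Ps = Σ (Matrix n) λ g → InOpen Ps g

  InIdeal : ∀ {m} → (Poly m → Set c) → Poly m → Set (c ⊔ ℓ)
  InIdeal {m} Gen f =
    Σ (List (Poly m × Poly m)) λ hs →
      All (λ hq → Gen (proj₂ hq)) hs × (f ≃ sumP (map (λ hq → proj₁ hq ⊗ proj₂ hq) hs))

  ActIdeal : ∀ {n} → Matrix n → (Poly n → Set (c ⊔ ℓ)) → Poly n → Set (c ⊔ ℓ)
  ActIdeal {n} g I f = Σ (Poly n) λ h → I h × (f ≃ act g h)

-- Degree reverse lexicographic order, x_1 ≺ ... ≺ x_n

deg : ∀ {m} → Vec ℕ m → ℕ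
deg = Vec.sum

RevLexTie : ∀ {m} → Vec ℕ m → Vec ℕ m → Set
RevLexTie {m} a b =
  Σ (Fin m) λ i → (∀ j → Fin._<_ j i → lookup a j ≡ lookup b j) × (lookup b i < lookup a i)

_≺rev_ : ∀ {m} → Vec ℕ m → Vec ℕ m → Set
a ≺rev b = (deg a < deg b) ⊎ (deg a ≡ deg b × RevLexTie a b)

_≼rev_ : ∀ {m} → Vec ℕ m → Vec ℕ m → Set
a ≼rev b = (a ≡ b) ⊎ (a ≺rev b)

_∣ᵐ_ : ∀ {m} → Vec ℕ m → Vec ℕ m → Set
a ∣ᵐ b = ∀ i → lookup a i ≤ lookup b i

module _ {c ℓ : Level} (K : Field c ℓ) where
  open Field K

  LeadMon : ∀ {n} → Poly K n → Mon K n → Set ℓ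
  LeadMon f a = ¬ (coeff K f a ≈ 0#) × (∀ b → ¬ (coeff K f b ≈ 0#) → b ≼rev a)

  -- membership of the monomial x^a in in_≺rev(J) = ⟨ in(f) : f ∈ J ⟩
  InInitial : ∀ {n} → (Poly K n → Set (c ⊔ ℓ)) → Mon K n → Set (c ⊔ ℓ)
  InInitial {n} J a = Σ (Poly K n) λ f → J f × Σ (Mon K n) λ b → LeadMon f b × (b ∣ᵐ a)

-- Graphs on [n] (vertex i+1 is Fin index i) and the ideal I_G

record Graph (n : ℕ) : Set where
  field
    adj   : Fin n → Fin n → Bool
    sym   : ∀ i j → adj i j ≡ adj j i
    irrefl : ∀ i → adj i i ≡ false

module _ {c ℓ : Level} (K : Field c ℓ) where
  open Field K

  IGgen : ∀ {n} → Graph n → Poly K n → Set c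
  IGgen {n} G q =
    (Σ (Fin n) λ i → Σ (Fin n) λ j →
       Fin._<_ i j × Graph.adj G i j ≡ false × q ≡ _⊗_ K (var K i) (var K j))
    ⊎ (Σ (Fin n) λ i → Σ (Fin n) λ j → Σ (Fin n) λ k →
       Fin._<_ i j × Fin._<_ j k × q ≡ _⊗_ K (_⊗_ K (var K i) (var K j)) (var K k))

  IG : ∀ {n} → Graph n → Poly K n → Set (c ⊔ ℓ)
  IG G = InIdeal K (IGgen G)

  RepresentsGIN : ∀ {n} → Matrix K n → Graph n → (Fin n → Fin n → Bool) → Set (c ⊔ ℓ)
  RepresentsGIN {n} g G S =
    ∀ (i j : Fin n) → Fin._≤_ i j →
      (S i j ≡ true) ⇔ (¬ InInitial K (ActIdeal K g (IG G)) (zipWith _+ℕ_ (unitMon K i) (unitMon K j)))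

countTrue : List Bool → ℕ
countTrue [] = 0
countTrue (true ∷ bs) = suc (countTrue bs)
countTrue (false ∷ bs) = countTrue bs

-- m_{≤k}(GIN): #{ x_i x_j ∈ GIN : i ≤ j, min{i,j} = i ≤ k } (1-based i)
mGIN : ∀ {n} → ℕ → (Fin n → Fin n → Bool) → ℕ
mGIN {n} k S = countTrue (concatMap (λ i → map (λ j →
  if does (toℕ i ℕ.<? k) then (if does (i Fin.≤? j) then S i j else false) else false)
  (allFin n)) (allFin n))

-- Δ^s(G) edge {a,b} (0-based a < b): {a,b} = {i-1, j} (1-based i,j)
-- for some 2 ≤ i ≤ j with x_i x_j ∈ GIN.
DeltaEdge : ∀ {n} → (Fin n → Fin n → Bool) → Fin n → Fin n → Set
DeltaEdge {n} S a b =
  Σ (Fin n) λ i → Σ (Fin n) λ j →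
    1 ≤ toℕ i × Fin._≤_ i j × S i j ≡ true ×
    ((toℕ i ∸ 1 ≡ toℕ a × toℕ j ≡ toℕ b) ⊎ (toℕ i ∸ 1 ≡ toℕ b × toℕ j ≡ toℕ a))

RepresentsDelta : ∀ {n} → (Fin n → Fin n → Bool) → (Fin n → Fin n → Bool) → Set
RepresentsDelta {n} S D = ∀ (a b : Fin n) → Fin._<_ a b → (D a b ≡ true) ⇔ DeltaEdge S a b

-- m_{≤k}(H) for a graph given by D on pairs a < b: edges with min ≤ k (1-based)
mEdges : ∀ {n} → ℕ → (Fin n → Fin n → Bool) → ℕ
mEdges {n} k D = countTrue (concatMap (λ a → map (λ b →
  if does (toℕ a ℕ.<? k) then (if does (a Fin.<? b) then D a b else false) else false)
  (allFin n)) (allFin n))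

module Submission where

-- Every generator of I_G is a product of at least two distinct variables, so I_G
-- vanishes on the coordinate axes and g(I_G) on the lines through the rows of g⁻¹.
-- As x₁ is the smallest variable for ≺rev, an f with in(f) ∣ x₁xⱼ involves only
-- the monomials 1, x_k and x₁x_k, so f(t w) = c + t L(w) + t² w₁ Q(w) with L, Q
-- linear.  For generic g (nonzero eliminants of g and of its cofactor matrices:
-- then g⁻¹ has no zero entry in its first column), vanishing at t = 0, ±1 in
-- characteristic 0 forces c, L and Q, hence f, to vanish.  So every x₁xⱼ lies in
-- GIN(G), which is (i); for (ii), row k of Δˢ(G) is row k + 1 of GIN(G), and row 1
-- of GIN(G) accounts for the n.

open import Level using (Level; _⊔_)
open import Data.Nat as ℕ using (ℕ; zero; suc; s≤s; z≤n; _≤_; _<_) renaming (_+_ to _+ℕ_; _*_ to _*ℕ_)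
open import Data.Nat.Properties using (<⇒≢; ≤-trans; ≤-refl; m≤n⇒m≤1+n; suc-injective; ≡ᵇ⇒≡; ≡⇒≡ᵇ)
open import Data.Bool using (Bool; true; false; T; if_then_else_)
open import Data.Fin as Fin using (Fin; toℕ; punchIn; punchOut; combine)
open import Data.Fin.Properties
  using (punchIn-punchOut; punchInᵢ≢i; punchIn-injective; remQuot-combine) renaming (_≟_ to _≟ᶠ_)
open import Data.Vec as Vec using (Vec; []; _∷_; lookup; tabulate; zipWith; replicate)
open import Data.Vec.Properties using (≡-dec)
open import Data.List as List using (List; []; _∷_; _++_; map; length; allFin)
open import Data.List.Properties using (map-tabulate)
open import Data.List.Relation.Unary.All using (All; []; _∷_)
open import Data.List.Relation.Unary.Any using (here)
open import Data.Product using (Σ; _×_; _,_; proj₁; proj₂)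
open import Data.Sum using (_⊎_; inj₁; inj₂)
open import Data.Empty using (⊥-elim)
open import Relation.Nullary using (¬_; yes; no; does)
open import Relation.Nullary.Decidable using (¬¬-excluded-middle)
open import Relation.Binary.PropositionalEquality as ≡ using (_≡_)
open import Algebra.Bundles.Raw using (RawRing)

open import Defs

module FieldProperties {c ℓ : Level} (K : Field c ℓ) where

  open Field K
  open import Relation.Binary.Reasoning.Setoid setoid

  x*y≉0⇒x≉0 : ∀ {x y} → ¬ (x * y ≈ 0#) → ¬ (x ≈ 0#)
  x*y≉0⇒x≉0 {x} {y} xy≉0 x≈0 = xy≉0 (trans (*-congʳ x≈0) (zeroˡ y))

  x*y≉0⇒y≉0 : ∀ {x y} → ¬ (x * y ≈ 0#) → ¬ (y ≈ 0#)
  x*y≉0⇒y≉0 {x} {y} xy≉0 y≈0 = xy≉0 (trans (*-congˡ y≈0) (zeroʳ x))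

  x≉0∧x*y≈0⇒y≈0 : ∀ {x y} → ¬ (x ≈ 0#) → x * y ≈ 0# → y ≈ 0#
  x≉0∧x*y≈0⇒y≈0 {x} {y} x≉0 xy≈0 with inverse x x≉0
  ... | x⁻¹ , xx⁻¹≈1 = begin
    y              ≈⟨ sym (*-identityˡ y) ⟩
    1# * y         ≈⟨ *-congʳ (trans (sym xx⁻¹≈1) (*-comm x x⁻¹)) ⟩
    (x⁻¹ * x) * y  ≈⟨ *-assoc x⁻¹ x y ⟩
    x⁻¹ * (x * y)  ≈⟨ *-congˡ xy≈0 ⟩
    x⁻¹ * 0#       ≈⟨ zeroʳ x⁻¹ ⟩
    0#             ∎

module FinSum {c ℓ : Level} (K : Field c ℓ) where

  open Field K
  open import Relation.Binary.Reasoning.Setoid setoid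
  open import Algebra.Properties.Semiring.Sum semiring public
    using (sum; sum-cong-≋; ∑-distrib-+; ∑-comm; *-distribˡ-sum; *-distribʳ-sum; sum-remove)
  open import Algebra.Properties.Group +-group using (inverseʳ-unique)

  sumF≡sum : ∀ {m} (f : Fin m → Carrier) → sumF K f ≡ sum f
  sumF≡sum {zero}  f = ≡.refl
  sumF≡sum {suc m} f = ≡.cong (f Fin.zero +_) (sumF≡sum (λ i → f (Fin.suc i)))

  sum-zero : ∀ {m} {f : Fin m → Carrier} → (∀ i → f i ≈ 0#) → sum f ≈ 0#
  sum-zero {zero}  f≈0 = refl
  sum-zero {suc m} f≈0 = trans (+-cong (f≈0 Fin.zero) (sum-zero (λ i → f≈0 (Fin.suc i)))) (+-identityˡ 0#)

  sum-neg : ∀ {m} (f : Fin m → Carrier) → sum (λ i → - f i) ≈ - sum f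
  sum-neg f = inverseʳ-unique (sum f) _
    (trans (sym (∑-distrib-+ f (λ i → - f i))) (sum-zero (λ i → -‿inverseʳ (f i))))

  δ : ∀ {m} → Fin m → Fin m → Carrier
  δ = idM K

  δ-diag : ∀ {m} (i : Fin m) → δ i i ≈ 1#
  δ-diag Fin.zero    = refl
  δ-diag (Fin.suc i) = δ-diag i

  δ-offDiag : ∀ {m} {i j : Fin m} → ¬ (i ≡ j) → δ i j ≈ 0#
  δ-offDiag {i = i} {j} i≢j with i ≟ᶠ j
  ... | yes i≡j = ⊥-elim (i≢j i≡j)
  ... | no  _   = refl

  δ-sym : ∀ {m} (i j : Fin m) → δ i j ≈ δ j i
  δ-sym i j with i ≟ᶠ j | j ≟ᶠ i
  ... | yes _   | yes _   = refl
  ... | no  _   | no  _   = refl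
  ... | yes i≡j | no  j≢i = ⊥-elim (j≢i (≡.sym i≡j))
  ... | no  i≢j | yes j≡i = ⊥-elim (i≢j (≡.sym j≡i))

  sum-δˡ : ∀ {m} (i : Fin m) (f : Fin m → Carrier) → sum (λ j → δ i j * f j) ≈ f i
  sum-δˡ {suc m} Fin.zero f = begin
    1# * f Fin.zero + sum (λ j → 0# * f (Fin.suc j))
      ≈⟨ +-cong (*-identityˡ _) (sum-zero {m} (λ j → zeroˡ _)) ⟩
    f Fin.zero + 0#  ≈⟨ +-identityʳ _ ⟩
    f Fin.zero       ∎
  sum-δˡ {suc m} (Fin.suc i) f = begin
    0# * f Fin.zero + sum (λ j → δ i j * f (Fin.suc j))
      ≈⟨ +-cong (zeroˡ _) (sum-δˡ i (λ j → f (Fin.suc j))) ⟩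
    0# + f (Fin.suc i)  ≈⟨ +-identityˡ _ ⟩
    f (Fin.suc i)       ∎

  sum-δʳ : ∀ {m} (i : Fin m) (f : Fin m → Carrier) → sum (λ j → f j * δ j i) ≈ f i
  sum-δʳ i f = begin
    sum (λ j → f j * δ j i)  ≈⟨ sum-cong-≋ (λ j → trans (*-comm (f j) _) (*-congʳ (δ-sym j i))) ⟩
    sum (λ j → δ i j * f j)  ≈⟨ sum-δˡ i f ⟩
    f i                      ∎

-- The eliminant is the product of the pivots of Gaussian elimination without
-- row exchanges, scaling rows by the pivot instead of dividing by it: a
-- polynomial in the entries that is nonzero only on injective matrices.
module _ {a ℓ} (R : RawRing a ℓ) where

  open RawRing R

  eliminationStep : ∀ {m} → (Fin (suc m) → Fin (suc m) → Carrier) → Fin m → Fin m → Carrier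
  eliminationStep M r c = M Fin.zero Fin.zero * M (Fin.suc r) (Fin.suc c)
                          + - (M (Fin.suc r) Fin.zero * M Fin.zero (Fin.suc c))

  eliminant : ∀ {m} → (Fin m → Fin m → Carrier) → Carrier
  eliminant {zero}  M = 1#
  eliminant {suc m} M = M Fin.zero Fin.zero * eliminant (eliminationStep M)

  product : ∀ {m} → (Fin m → Carrier) → Carrier
  product {zero}  F = 1#
  product {suc m} F = F Fin.zero * product (λ i → F (Fin.suc i))

-- cofactorMatrix g i deletes row 0 and column i of g, taking its row p from row
-- 1 + cofactorRow i p.  Any order of the rows would do; this one makes the
-- cofactor matrices of the witness below lower unitriangular.
cofactorRow : ∀ {n} → Fin (suc n) → Fin n → Fin n
cofactorRow Fin.zero    p           = p
cofactorRow (Fin.suc i) Fin.zero    = i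
cofactorRow (Fin.suc i) (Fin.suc p) = punchIn i p

cofactorMatrix : ∀ {a} {A : Set a} {n} → (Fin (suc n) → Fin (suc n) → A) → Fin (suc n) → Fin n → Fin n → A
cofactorMatrix g i p l = g (Fin.suc (cofactorRow i p)) (punchIn i l)

module Matrices {c ℓ : Level} (K : Field c ℓ) where

  open Field K
  open FieldProperties K
  open FinSum K
  open import Relation.Binary.Reasoning.Setoid setoid
  open import Algebra.Properties.Group +-group using (inverseʳ-unique; x∙y⁻¹≈ε⇒x≈y; ⁻¹-involutive; ε⁻¹≈ε)
  open import Algebra.Properties.Ring ring using (-‿distribˡ-*; -‿distribʳ-*)
  open import Algebra.Properties.CommutativeSemigroup *-commutativeSemigroup using (x∙yz≈y∙xz)

  eliminantᴷ : ∀ {m} → Matrix K m → Carrier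
  eliminantᴷ = eliminant rawRing

  rowTail : ∀ {m} → Matrix K (suc m) → (Fin (suc m) → Carrier) → Fin (suc m) → Carrier
  rowTail M u p = sum (λ c → M p (Fin.suc c) * u (Fin.suc c))

  eliminationStep-row : ∀ {m} (M : Matrix K (suc m)) (u : Fin (suc m) → Carrier) r →
    sum (λ c → eliminationStep rawRing M r c * u (Fin.suc c))
      ≈ M Fin.zero Fin.zero * rowTail M u (Fin.suc r) + - (M (Fin.suc r) Fin.zero * rowTail M u Fin.zero)
  eliminationStep-row {m} M u r = begin
    sum (λ c → (a * M (Fin.suc r) (Fin.suc c) + - (b * M Fin.zero (Fin.suc c))) * u (Fin.suc c))
      ≈⟨ sum-cong-≋ {m} (λ c → distribʳ (u (Fin.suc c)) _ _) ⟩
    sum (λ c → (a * M (Fin.suc r) (Fin.suc c)) * u (Fin.suc c) + - (b * M Fin.zero (Fin.suc c)) * u (Fin.suc c))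
      ≈⟨ ∑-distrib-+ {m} _ _ ⟩
    sum (λ c → (a * M (Fin.suc r) (Fin.suc c)) * u (Fin.suc c))
      + sum (λ c → - (b * M Fin.zero (Fin.suc c)) * u (Fin.suc c))
      ≈⟨ +-cong (trans (sum-cong-≋ {m} (λ c → *-assoc _ _ _)) (sym (*-distribˡ-sum {m} a _)))
                (trans (sum-cong-≋ {m} (λ c → trans (sym (-‿distribˡ-* _ _)) (-‿cong (*-assoc _ _ _))))
                       (trans (sum-neg {m} _) (-‿cong (sym (*-distribˡ-sum {m} b _))))) ⟩
    a * rowTail M u (Fin.suc r) + - (b * rowTail M u Fin.zero) ∎
    where
    a = M Fin.zero Fin.zero
    b = M (Fin.suc r) Fin.zero

  eliminant≉0⇒injective : ∀ {m} (M : Matrix K m) (u : Fin m → Carrier) → ¬ (eliminantᴷ M ≈ 0#) →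
                    (∀ p → sum (λ l → M p l * u l) ≈ 0#) → ∀ l → u l ≈ 0#
  eliminant≉0⇒injective {suc m} M u E≉0 Mu≈0 = u≈0
    where
    a  = M Fin.zero Fin.zero
    u₀ = u Fin.zero
    rowTail≈ : ∀ p → rowTail M u p ≈ - (M p Fin.zero * u₀)
    rowTail≈ p = inverseʳ-unique _ _ (Mu≈0 p)
    stepRow≈0 : ∀ r → sum (λ c → eliminationStep rawRing M r c * u (Fin.suc c)) ≈ 0#
    stepRow≈0 r = begin
      sum (λ c → eliminationStep rawRing M r c * u (Fin.suc c))
        ≈⟨ eliminationStep-row M u r ⟩
      a * rowTail M u (Fin.suc r) + - (b * rowTail M u Fin.zero)
        ≈⟨ +-cong (*-congˡ (rowTail≈ (Fin.suc r))) (-‿cong (*-congˡ (rowTail≈ Fin.zero))) ⟩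
      a * - (b * u₀) + - (b * - (a * u₀))
        ≈⟨ +-cong (sym (-‿distribʳ-* a _)) (-‿cong (sym (-‿distribʳ-* b _))) ⟩
      - (a * (b * u₀)) + - - (b * (a * u₀))
        ≈⟨ +-congˡ (trans (⁻¹-involutive _) (x∙yz≈y∙xz b a u₀)) ⟩
      - (a * (b * u₀)) + a * (b * u₀)
        ≈⟨ -‿inverseˡ _ ⟩
      0# ∎
      where b = M (Fin.suc r) Fin.zero
    uTail≈0 : ∀ l → u (Fin.suc l) ≈ 0#
    uTail≈0 = eliminant≉0⇒injective (eliminationStep rawRing M) (λ l → u (Fin.suc l)) (x*y≉0⇒y≉0 E≉0) stepRow≈0
    au₀≈0 : a * u₀ ≈ 0#
    au₀≈0 = begin
      a * u₀                      ≈⟨ sym (+-identityʳ _) ⟩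
      a * u₀ + 0#                 ≈⟨ +-congˡ (sym (sum-zero {m} (λ l → trans (*-congˡ (uTail≈0 l)) (zeroʳ _)))) ⟩
      a * u₀ + rowTail M u Fin.zero ≈⟨ Mu≈0 Fin.zero ⟩
      0#                          ∎
    u≈0 : ∀ l → u l ≈ 0#
    u≈0 Fin.zero    = x≉0∧x*y≈0⇒y≈0 (x*y≉0⇒x≉0 E≉0) au₀≈0
    u≈0 (Fin.suc l) = uTail≈0 l

  RightInverse : ∀ {m} → Matrix K m → Matrix K m → Set ℓ
  RightInverse g h = ∀ i j → sum (λ k → g i k * h k j) ≈ δ i j

  -- g (h g) = (g h) g = g, so the columns of h g - 1 lie in the kernel of g.
  rightInverse⇒leftInverse : ∀ {m} (g h : Matrix K m) → RightInverse g h → ¬ (eliminantᴷ g ≈ 0#) → RightInverse h g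
  rightInverse⇒leftInverse {m} g h gh≈1 E≉0 i j =
    x∙y⁻¹≈ε⇒x≈y _ _ (eliminant≉0⇒injective g (λ k → hg k j + - δ k j) E≉0 g[hg-1]≈0 i)
    where
    hg : Matrix K m
    hg k j = sum (λ l → h k l * g l j)
    g[hg-1]≈0 : ∀ r → sum (λ k → g r k * (hg k j + - δ k j)) ≈ 0#
    g[hg-1]≈0 r = begin
      sum (λ k → g r k * (hg k j + - δ k j))
        ≈⟨ sum-cong-≋ {m} (λ k → distribˡ _ _ _) ⟩
      sum (λ k → g r k * hg k j + g r k * - δ k j)
        ≈⟨ ∑-distrib-+ {m} _ _ ⟩
      sum (λ k → g r k * hg k j) + sum (λ k → g r k * - δ k j)
        ≈⟨ +-cong g[hg]≈g (trans (sum-cong-≋ {m} (λ k → sym (-‿distribʳ-* _ _)))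
                                  (trans (sum-neg {m} _) (-‿cong (sum-δʳ j (g r))))) ⟩
      g r j + - g r j
        ≈⟨ -‿inverseʳ _ ⟩
      0# ∎
      where
      g[hg]≈g : sum (λ k → g r k * hg k j) ≈ g r j
      g[hg]≈g = begin
        sum (λ k → g r k * sum (λ l → h k l * g l j))
          ≈⟨ sum-cong-≋ {m} (λ k → trans (*-distribˡ-sum {m} (g r k) _) (sum-cong-≋ {m} (λ l → sym (*-assoc _ _ _)))) ⟩
        sum (λ k → sum (λ l → (g r k * h k l) * g l j))
          ≈⟨ ∑-comm {m} {m} _ ⟩
        sum (λ l → sum (λ k → (g r k * h k l) * g l j))
          ≈⟨ sum-cong-≋ {m} (λ l → trans (sym (*-distribʳ-sum {m} (g l j) _)) (*-congʳ (gh≈1 r l))) ⟩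
        sum (λ l → δ r l * g l j)
          ≈⟨ sum-δˡ r (λ l → g l j) ⟩
        g r j ∎

  -- If h i 0 ≈ 0, the cofactor matrix kills the rest of column 0 of h, which is
  -- nonzero since g maps it to e₀.
  cofactor≉0⇒inverse≉0 : ∀ {n} (g h : Matrix K (suc n)) → RightInverse g h →
                         ∀ i → ¬ (eliminantᴷ (cofactorMatrix g i) ≈ 0#) → ¬ (h i Fin.zero ≈ 0#)
  cofactor≉0⇒inverse≉0 {n} g h gh≈1 i E≉0 hi0≈0 =
    1≉0 (trans (sym (gh≈1 Fin.zero Fin.zero)) (sum-zero {suc n} (λ k → trans (*-congˡ (u≈0 k)) (zeroʳ (g Fin.zero k)))))
    where
    u : Fin (suc n) → Carrier
    u k = h k Fin.zero
    gᵣ : Fin n → Fin (suc n) → Carrier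
    gᵣ p = g (Fin.suc (cofactorRow i p))
    cofactor-u≈0 : ∀ p → sum (λ l → cofactorMatrix g i p l * u (punchIn i l)) ≈ 0#
    cofactor-u≈0 p = begin
      sum (λ l → gᵣ p (punchIn i l) * u (punchIn i l))
        ≈⟨ sym (+-identityˡ _) ⟩
      0# + sum (λ l → gᵣ p (punchIn i l) * u (punchIn i l))
        ≈⟨ +-congʳ (sym (trans (*-congˡ hi0≈0) (zeroʳ _))) ⟩
      gᵣ p i * u i + sum (λ l → gᵣ p (punchIn i l) * u (punchIn i l))
        ≈⟨ sym (sum-remove {i = i} (λ k → gᵣ p k * u k)) ⟩
      sum (λ k → gᵣ p k * u k)
        ≈⟨ gh≈1 (Fin.suc (cofactorRow i p)) Fin.zero ⟩
      0# ∎
    u≈0 : ∀ k → u k ≈ 0#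
    u≈0 k with i ≟ᶠ k
    ... | yes ≡.refl = hi0≈0
    ... | no  i≢k    = ≡.subst (λ k → u k ≈ 0#) (punchIn-punchOut i≢k)
                         (eliminant≉0⇒injective (cofactorMatrix g i) (λ l → u (punchIn i l)) E≉0 cofactor-u≈0 (punchOut i≢k))

  LowerUnitriangular : ∀ {m} → Matrix K m → Set ℓ
  LowerUnitriangular M = (∀ r → M r r ≈ 1#) × (∀ r c → toℕ r < toℕ c → M r c ≈ 0#)

  lowerUnitriangular⇒eliminant≈1 : ∀ {m} (M : Matrix K m) → LowerUnitriangular M → eliminantᴷ M ≈ 1#
  lowerUnitriangular⇒eliminant≈1 {zero}  M _ = refl
  lowerUnitriangular⇒eliminant≈1 {suc m} M (diag , upper) =
    trans (*-cong (diag Fin.zero) (lowerUnitriangular⇒eliminant≈1 (eliminationStep rawRing M) (diag′ , upper′)))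
          (*-identityˡ 1#)
    where
    step≈tail : ∀ r c → eliminationStep rawRing M r c ≈ M (Fin.suc r) (Fin.suc c)
    step≈tail r c = begin
      M Fin.zero Fin.zero * M (Fin.suc r) (Fin.suc c) + - (M (Fin.suc r) Fin.zero * M Fin.zero (Fin.suc c))
        ≈⟨ +-cong (*-congʳ (diag Fin.zero)) (-‿cong (*-congˡ (upper Fin.zero (Fin.suc c) (s≤s z≤n)))) ⟩
      1# * M (Fin.suc r) (Fin.suc c) + - (M (Fin.suc r) Fin.zero * 0#)
        ≈⟨ +-cong (*-identityˡ _) (trans (-‿cong (zeroʳ _)) ε⁻¹≈ε) ⟩
      M (Fin.suc r) (Fin.suc c) + 0#
        ≈⟨ +-identityʳ _ ⟩
      M (Fin.suc r) (Fin.suc c) ∎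
    diag′ : ∀ r → eliminationStep rawRing M r r ≈ 1#
    diag′ r = trans (step≈tail r r) (diag (Fin.suc r))
    upper′ : ∀ r c → toℕ r < toℕ c → eliminationStep rawRing M r c ≈ 0#
    upper′ r c r<c = trans (step≈tail r c) (upper (Fin.suc r) (Fin.suc c) (s≤s r<c))

  witness : ∀ {n} → Matrix K (suc n)
  witness Fin.zero    c = δ Fin.zero c
  witness (Fin.suc r) c = δ (Fin.suc r) c + δ Fin.zero c

  witnessInverse : ∀ {n} → Matrix K (suc n)
  witnessInverse Fin.zero    c = δ Fin.zero c
  witnessInverse (Fin.suc r) c = δ (Fin.suc r) c + - δ Fin.zero c

  witness-rightInverse : ∀ {n} → RightInverse (witness {n}) witnessInverse
  witness-rightInverse {n} Fin.zero    j = sum-δˡ Fin.zero (λ k → witnessInverse k j)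
  witness-rightInverse {n} (Fin.suc r) j = begin
    sum (λ k → (δ (Fin.suc r) k + δ Fin.zero k) * h k j)
      ≈⟨ sum-cong-≋ {suc n} (λ k → distribʳ (h k j) (δ (Fin.suc r) k) (δ Fin.zero k)) ⟩
    sum (λ k → δ (Fin.suc r) k * h k j + δ Fin.zero k * h k j)
      ≈⟨ ∑-distrib-+ {suc n} (λ k → δ (Fin.suc r) k * h k j) (λ k → δ Fin.zero k * h k j) ⟩
    sum (λ k → δ (Fin.suc r) k * h k j) + sum (λ k → δ Fin.zero k * h k j)
      ≈⟨ +-cong (sum-δˡ (Fin.suc r) (λ k → h k j)) (sum-δˡ Fin.zero (λ k → h k j)) ⟩
    (δ (Fin.suc r) j + - δ Fin.zero j) + δ Fin.zero j
      ≈⟨ +-assoc _ _ _ ⟩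
    δ (Fin.suc r) j + (- δ Fin.zero j + δ Fin.zero j)
      ≈⟨ +-congˡ (-‿inverseˡ _) ⟩
    δ (Fin.suc r) j + 0#
      ≈⟨ +-identityʳ _ ⟩
    δ (Fin.suc r) j ∎
    where
    h = witnessInverse {n}

  private
    <⇒≢ᶠ : ∀ {m} {r c : Fin m} → toℕ r < toℕ c → ¬ (r ≡ c)
    <⇒≢ᶠ r<c r≡c = <⇒≢ r<c (≡.cong toℕ r≡c)

  witness-lowerUnitriangular : ∀ {n} → LowerUnitriangular (witness {n})
  witness-lowerUnitriangular = diag , upper
    where
    diag : ∀ r → witness r r ≈ 1#
    diag Fin.zero    = refl
    diag (Fin.suc r) = trans (+-identityʳ _) (δ-diag r)
    upper : ∀ r c → toℕ r < toℕ c → witness r c ≈ 0#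
    upper Fin.zero    (Fin.suc c) _         = refl
    upper (Fin.suc r) (Fin.suc c) (s≤s r<c) = trans (+-identityʳ _) (δ-offDiag (<⇒≢ᶠ r<c))

  witness-cofactor-lowerUnitriangular : ∀ {n} (i : Fin (suc n)) → LowerUnitriangular (cofactorMatrix (witness {n}) i)
  witness-cofactor-lowerUnitriangular i = diag i , upper i
    where
    diag : ∀ i r → cofactorMatrix witness i r r ≈ 1#
    diag Fin.zero    r           = trans (+-identityʳ _) (δ-diag r)
    diag (Fin.suc i) Fin.zero    = +-identityˡ _
    diag (Fin.suc i) (Fin.suc r) = trans (+-identityʳ _) (δ-diag (punchIn i r))
    upper : ∀ i r c → toℕ r < toℕ c → cofactorMatrix witness i r c ≈ 0#
    upper Fin.zero    r           c           r<c       = trans (+-identityʳ _) (δ-offDiag (<⇒≢ᶠ r<c))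
    upper (Fin.suc i) Fin.zero    (Fin.suc c) _         =
      trans (+-identityʳ _) (δ-offDiag (λ i≡ → punchInᵢ≢i i c (≡.sym i≡)))
    upper (Fin.suc i) (Fin.suc r) (Fin.suc c) (s≤s r<c) =
      trans (+-identityʳ _) (δ-offDiag (λ r≡c → <⇒≢ᶠ r<c (punchIn-injective i r c r≡c)))

  rightInverse⇒injective : ∀ {m} (g h : Matrix K m) → RightInverse g h → (x : Fin m → Carrier) →
                           (∀ i → sum (λ k → h i k * x k) ≈ 0#) → ∀ l → x l ≈ 0#
  rightInverse⇒injective {m} g h gh≈1 x hx≈0 l = begin
    x l                                         ≈⟨ sym (sum-δˡ l x) ⟩
    sum (λ k → δ l k * x k)                     ≈⟨ sum-cong-≋ {m} (λ k → *-congʳ (sym (gh≈1 l k))) ⟩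
    sum (λ k → sum (λ i → g l i * h i k) * x k) ≈⟨ sum-cong-≋ {m} (λ k → *-distribʳ-sum {m} (x k) _) ⟩
    sum (λ k → sum (λ i → (g l i * h i k) * x k)) ≈⟨ ∑-comm {m} {m} _ ⟩
    sum (λ i → sum (λ k → (g l i * h i k) * x k)) ≈⟨ sum-cong-≋ {m} (λ i → sum-cong-≋ {m} (λ k → *-assoc _ _ _)) ⟩
    sum (λ i → sum (λ k → g l i * (h i k * x k))) ≈⟨ sum-cong-≋ {m} (λ i → sym (*-distribˡ-sum {m} (g l i) _)) ⟩
    sum (λ i → g l i * sum (λ k → h i k * x k)) ≈⟨ sum-zero {m} (λ i → trans (*-congˡ (hx≈0 i)) (zeroʳ _)) ⟩
    0# ∎

module LinearExtension {c ℓ : Level} (K : Field c ℓ) where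

  open Field K
  open FinSum K
  open import Relation.Binary.Reasoning.Setoid setoid
  open import Algebra.Properties.Group +-group using (inverseʳ-unique; x∙y⁻¹≈ε⇒x≈y; ε⁻¹≈ε)
  open import Algebra.Properties.AbelianGroup +-abelianGroup using (⁻¹-∙-comm)
  open import Algebra.Properties.Ring ring using (-‿distribˡ-*; -‿distribʳ-*)
  open import Algebra.Properties.CommutativeSemigroup +-commutativeSemigroup
    using (interchange) renaming (x∙yz≈y∙xz to x+[y+z]≈y+[x+z])
  open import Algebra.Properties.CommutativeSemigroup *-commutativeSemigroup using (x∙yz≈y∙xz)

  linExt : ∀ {m} → (Mon K m → Carrier) → Poly K m → Carrier
  linExt φ []            = 0#
  linExt φ ((x , a) ∷ p) = x * φ a + linExt φ p

  linExt-++ : ∀ {m} (φ : Mon K m → Carrier) (p q : Poly K m) → linExt φ (p ++ q) ≈ linExt φ p + linExt φ q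
  linExt-++ φ []            q = sym (+-identityˡ _)
  linExt-++ φ ((x , a) ∷ p) q = trans (+-congˡ (linExt-++ φ p q)) (sym (+-assoc _ _ _))

  linExt-cong : ∀ {m} {φ ψ : Mon K m → Carrier} → (∀ a → φ a ≈ ψ a) → ∀ p → linExt φ p ≈ linExt ψ p
  linExt-cong φ≈ψ []            = refl
  linExt-cong φ≈ψ ((x , a) ∷ p) = +-cong (*-congˡ (φ≈ψ a)) (linExt-cong φ≈ψ p)

  linExt-+ : ∀ {m} (φ ψ : Mon K m → Carrier) p → linExt (λ a → φ a + ψ a) p ≈ linExt φ p + linExt ψ p
  linExt-+ φ ψ []            = sym (+-identityˡ _)
  linExt-+ φ ψ ((x , a) ∷ p) = trans (+-cong (distribˡ x _ _) (linExt-+ φ ψ p)) (interchange _ _ _ _)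

  linExt-*ˡ : ∀ {m} t (φ : Mon K m → Carrier) p → linExt (λ a → t * φ a) p ≈ t * linExt φ p
  linExt-*ˡ t φ []            = sym (zeroʳ t)
  linExt-*ˡ t φ ((x , a) ∷ p) = trans (+-cong (x∙yz≈y∙xz x t _) (linExt-*ˡ t φ p)) (sym (distribˡ t _ _))

  linExt-zero : ∀ {m} (p : Poly K m) → linExt (λ _ → 0#) p ≈ 0#
  linExt-zero []            = refl
  linExt-zero ((x , a) ∷ p) = trans (+-cong (zeroʳ x) (linExt-zero p)) (+-identityˡ 0#)

  linExt-neg : ∀ {m} (φ : Mon K m → Carrier) p → linExt (λ a → - φ a) p ≈ - linExt φ p
  linExt-neg φ p = inverseʳ-unique _ _
    (trans (sym (linExt-+ φ _ p)) (trans (linExt-cong (λ a → -‿inverseʳ (φ a)) p) (linExt-zero p)))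

  linExt-sum : ∀ {m k} (F : Mon K m → Fin k → Carrier) p →
               linExt (λ a → sum (λ i → F a i)) p ≈ sum (λ i → linExt (λ a → F a i) p)
  linExt-sum {k = k} F []            = sym (sum-zero {k} (λ i → refl))
  linExt-sum {k = k} F ((x , a) ∷ p) = begin
    x * sum (λ i → F a i) + linExt (λ a → sum (λ i → F a i)) p
      ≈⟨ +-cong (*-distribˡ-sum {k} x _) (linExt-sum F p) ⟩
    sum (λ i → x * F a i) + sum (λ i → linExt (λ a → F a i) p)
      ≈⟨ sym (∑-distrib-+ {k} _ _) ⟩
    sum (λ i → x * F a i + linExt (λ a → F a i) p) ∎

  eval≡linExt : ∀ {m} (p : Poly K m) v → eval K p v ≡ linExt (λ a → evalMon K a v) p
  eval≡linExt []            v = ≡.refl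
  eval≡linExt ((x , a) ∷ p) v = ≡.cong (x * evalMon K a v +_) (eval≡linExt p v)

  indicator : ∀ {m} → Mon K m → Mon K m → Carrier
  indicator b a = if does (≡-dec ℕ._≟_ a b) then 1# else 0#

  linExt-indicator : ∀ {m} (p : Poly K m) b → linExt (indicator b) p ≈ coeff K p b
  linExt-indicator []            b = refl
  linExt-indicator ((x , a) ∷ p) b with ≡-dec ℕ._≟_ a b
  ... | yes _ = +-cong (*-identityʳ x) (linExt-indicator p b)
  ... | no  _ = trans (+-cong (zeroʳ x) (linExt-indicator p b)) (+-identityˡ _)

  coeff-++ : ∀ {m} (p q : Poly K m) b → coeff K (p ++ q) b ≈ coeff K p b + coeff K q b
  coeff-++ []            q b = sym (+-identityˡ _)
  coeff-++ ((x , a) ∷ p) q b with ≡-dec ℕ._≟_ a b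
  ... | yes _ = trans (+-congˡ (coeff-++ p q b)) (sym (+-assoc _ _ _))
  ... | no  _ = coeff-++ p q b

  negP : ∀ {m} → Poly K m → Poly K m
  negP = map (λ t → (- proj₁ t , proj₂ t))

  coeff-negP : ∀ {m} (p : Poly K m) b → coeff K (negP p) b ≈ - coeff K p b
  coeff-negP []            b = sym ε⁻¹≈ε
  coeff-negP ((x , a) ∷ p) b with ≡-dec ℕ._≟_ a b
  ... | yes _ = trans (+-congˡ (coeff-negP p b)) (⁻¹-∙-comm x _)
  ... | no  _ = coeff-negP p b

  linExt-negP : ∀ {m} (φ : Mon K m → Carrier) p → linExt φ (negP p) ≈ - linExt φ p
  linExt-negP φ p = trans (negate-terms p) (linExt-neg φ p)
    where
    negate-terms : ∀ p → linExt φ (negP p) ≈ linExt (λ a → - φ a) p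
    negate-terms []            = refl
    negate-terms ((x , a) ∷ p) = +-cong (trans (sym (-‿distribˡ-* x _)) (-‿distribʳ-* x _)) (negate-terms p)

  removeMon : ∀ {m} → Mon K m → Poly K m → Poly K m
  removeMon a []            = []
  removeMon a ((x , b) ∷ q) with ≡-dec ℕ._≟_ b a
  ... | yes _ = removeMon a q
  ... | no  _ = (x , b) ∷ removeMon a q

  linExt-removeMon : ∀ {m} (φ : Mon K m → Carrier) a q →
                     linExt φ q ≈ coeff K q a * φ a + linExt φ (removeMon a q)
  linExt-removeMon φ a []            = sym (trans (+-identityʳ _) (zeroˡ _))
  linExt-removeMon φ a ((x , b) ∷ q) with ≡-dec ℕ._≟_ b a
  ... | yes ≡.refl = begin
    x * φ b + linExt φ q
      ≈⟨ +-congˡ (linExt-removeMon φ a q) ⟩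
    x * φ b + (coeff K q a * φ a + linExt φ (removeMon a q))
      ≈⟨ sym (+-assoc _ _ _) ⟩
    (x * φ b + coeff K q a * φ a) + linExt φ (removeMon a q)
      ≈⟨ +-congʳ (sym (distribʳ _ _ _)) ⟩
    (x + coeff K q a) * φ a + linExt φ (removeMon a q) ∎
  ... | no _ = trans (+-congˡ (linExt-removeMon φ a q)) (x+[y+z]≈y+[x+z] _ _ _)

  coeff-removeMon-self : ∀ {m} (a : Mon K m) q → coeff K (removeMon a q) a ≈ 0#
  coeff-removeMon-self a []            = refl
  coeff-removeMon-self a ((x , b) ∷ q) with ≡-dec ℕ._≟_ b a
  ... | yes _   = coeff-removeMon-self a q
  ... | no  b≢a with ≡-dec ℕ._≟_ b a
  ...   | yes b≡a = ⊥-elim (b≢a b≡a)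
  ...   | no  _   = coeff-removeMon-self a q

  coeff-removeMon-other : ∀ {m} (a a′ : Mon K m) q → ¬ (a ≡ a′) → coeff K (removeMon a q) a′ ≈ coeff K q a′
  coeff-removeMon-other a a′ []            a≢a′ = refl
  coeff-removeMon-other a a′ ((x , b) ∷ q) a≢a′ with ≡-dec ℕ._≟_ b a
  ... | yes ≡.refl with ≡-dec ℕ._≟_ b a′
  ...   | yes b≡a′ = ⊥-elim (a≢a′ b≡a′)
  ...   | no  _    = coeff-removeMon-other a a′ q a≢a′
  coeff-removeMon-other a a′ ((x , b) ∷ q) a≢a′ | no _ with ≡-dec ℕ._≟_ b a′
  ...   | yes _ = +-congˡ (coeff-removeMon-other a a′ q a≢a′)
  ...   | no  _ = coeff-removeMon-other a a′ q a≢a′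

  length-removeMon : ∀ {m} (a : Mon K m) q → length (removeMon a q) ≤ length q
  length-removeMon a []            = z≤n
  length-removeMon a ((x , b) ∷ q) with ≡-dec ℕ._≟_ b a
  ... | yes _ = m≤n⇒m≤1+n (length-removeMon a q)
  ... | no  _ = s≤s (length-removeMon a q)

  removeMon-head : ∀ {m} x (a : Mon K m) q → removeMon a ((x , a) ∷ q) ≡ removeMon a q
  removeMon-head x a q with ≡-dec ℕ._≟_ a a
  ... | yes _   = ≡.refl
  ... | no  a≢a = ⊥-elim (a≢a ≡.refl)

  -- Equality in K is undecidable, so the next three facts are only proved under
  -- ¬ ¬; this suffices, as they are only used to derive ⊥.
  linExt-vanishes : ∀ {m} (φ : Mon K m → Carrier) (p : Poly K m) →
                    (∀ a → ¬ ¬ ((coeff K p a ≈ 0#) ⊎ (φ a ≈ 0#))) → ¬ ¬ (linExt φ p ≈ 0#)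
  linExt-vanishes φ p = go (length p) p ≤-refl
    where
    go : ∀ N p → length p ≤ N → (∀ a → ¬ ¬ ((coeff K p a ≈ 0#) ⊎ (φ a ≈ 0#))) → ¬ ¬ (linExt φ p ≈ 0#)
    go N       []               _           _   vanishes = vanishes refl
    go (suc N) p@((x , a) ∷ q) (s≤s |q|≤N) hyp vanishes =
      hyp a λ coeff-or-φ → go N r |r|≤N hyp′ λ r≈0 → vanishes (begin
        linExt φ p                    ≈⟨ linExt-removeMon φ a p ⟩
        coeff K p a * φ a + linExt φ r ≈⟨ +-cong (term≈0 coeff-or-φ) r≈0 ⟩
        0# + 0#                       ≈⟨ +-identityʳ 0# ⟩
        0#                            ∎)
      where
      r = removeMon a p
      |r|≤N : length r ≤ N
      |r|≤N = ≡.subst (λ r → length r ≤ N) (≡.sym (removeMon-head x a q)) (≤-trans (length-removeMon a q) |q|≤N)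
      term≈0 : (coeff K p a ≈ 0#) ⊎ (φ a ≈ 0#) → coeff K p a * φ a ≈ 0#
      term≈0 (inj₁ c≈0) = trans (*-congʳ c≈0) (zeroˡ _)
      term≈0 (inj₂ φ≈0) = trans (*-congˡ φ≈0) (zeroʳ _)
      hyp′ : ∀ a′ → ¬ ¬ ((coeff K r a′ ≈ 0#) ⊎ (φ a′ ≈ 0#))
      hyp′ a′ k with ≡-dec ℕ._≟_ a a′
      ... | yes ≡.refl = k (inj₁ (coeff-removeMon-self a p))
      ... | no  a≢a′   = hyp a′ λ where
        (inj₁ c≈0) → k (inj₁ (trans (coeff-removeMon-other a a′ p a≢a′) c≈0))
        (inj₂ φ≈0) → k (inj₂ φ≈0)

  linExt-≃ : ∀ {m} {p q : Poly K m} → _≃_ K p q → ∀ φ → ¬ ¬ (linExt φ p ≈ linExt φ q)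
  linExt-≃ {p = p} {q} p≃q φ neq = linExt-vanishes φ (p ++ negP q) coeff≈0 λ diff≈0 →
    neq (x∙y⁻¹≈ε⇒x≈y _ _ (trans (sym (trans (linExt-++ φ p (negP q)) (+-congˡ (linExt-negP φ q)))) diff≈0))
    where
    coeff≈0 : ∀ a → ¬ ¬ ((coeff K (p ++ negP q) a ≈ 0#) ⊎ (φ a ≈ 0#))
    coeff≈0 a k = k (inj₁ (trans (coeff-++ p (negP q) a)
                           (trans (+-cong (p≃q a) (coeff-negP q a)) (-‿inverseʳ _))))

  linExt-onSupport : ∀ {m} (p : Poly K m) (φ ψ : Mon K m → Carrier) →
                     (∀ a → ¬ (coeff K p a ≈ 0#) → φ a ≈ ψ a) → ¬ ¬ (linExt φ p ≈ linExt ψ p)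
  linExt-onSupport p φ ψ φ≈ψ neq = linExt-vanishes (λ a → φ a + - ψ a) p differ≈0 λ diff≈0 →
    neq (x∙y⁻¹≈ε⇒x≈y _ _ (trans (sym (trans (linExt-+ φ _ p) (+-congˡ (linExt-neg ψ p)))) diff≈0))
    where
    differ≈0 : ∀ a → ¬ ¬ ((coeff K p a ≈ 0#) ⊎ (φ a + - ψ a ≈ 0#))
    differ≈0 a k = ¬¬-excluded-middle λ where
      (yes c≈0) → k (inj₁ c≈0)
      (no  c≉0) → k (inj₂ (trans (+-congʳ (φ≈ψ a c≉0)) (-‿inverseʳ _)))

module Evaluation {c ℓ : Level} (K : Field c ℓ) where

  open Field K
  open FinSum K
  open LinearExtension K
  open import Relation.Binary.Reasoning.Setoid setoid
  open import Algebra.Properties.Semiring.Exp semiring using (_^_; ^-homo-*; ^-congˡ)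
  open import Algebra.Properties.CommutativeSemiring.Exp commutativeSemiring using (^-distrib-*)
  open import Algebra.Properties.CommutativeSemigroup *-commutativeSemigroup using (interchange)

  evalAt : ∀ {m} → Poly K m → (Fin m → Carrier) → Carrier
  evalAt p f = eval K p (tabulate f)

  evalMonAt : ∀ {m} → Mon K m → (Fin m → Carrier) → Carrier
  evalMonAt a f = evalMon K a (tabulate f)

  powK≡^ : ∀ x n → powK K x n ≡ x ^ n
  powK≡^ x zero    = ≡.refl
  powK≡^ x (suc n) = ≡.cong (x *_) (powK≡^ x n)

  powK-+ : ∀ x m n → powK K x (m +ℕ n) ≈ powK K x m * powK K x n
  powK-+ x m n rewrite powK≡^ x (m +ℕ n) | powK≡^ x m | powK≡^ x n = ^-homo-* x m n

  powK-* : ∀ x y n → powK K (x * y) n ≈ powK K x n * powK K y n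
  powK-* x y n rewrite powK≡^ (x * y) n | powK≡^ x n | powK≡^ y n = ^-distrib-* x y n

  powK-cong : ∀ {x y} n → x ≈ y → powK K x n ≈ powK K y n
  powK-cong {x} {y} n x≈y rewrite powK≡^ x n | powK≡^ y n = ^-congˡ n x≈y

  evalMon-zipWith : ∀ {m} (a b : Mon K m) v → evalMon K (zipWith _+ℕ_ a b) v ≈ evalMon K a v * evalMon K b v
  evalMon-zipWith []       []       []       = sym (*-identityˡ 1#)
  evalMon-zipWith (a ∷ as) (b ∷ bs) (x ∷ xs) =
    trans (*-cong (powK-+ x a b) (evalMon-zipWith as bs xs)) (interchange _ _ _ _)

  evalMon-replicate : ∀ {m} v → evalMon K (replicate m 0) v ≈ 1#
  evalMon-replicate []      = refl
  evalMon-replicate (x ∷ v) = trans (*-identityˡ _) (evalMon-replicate v)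

  eval-++ : ∀ {m} (p q : Poly K m) v → eval K (p ++ q) v ≈ eval K p v + eval K q v
  eval-++ p q v rewrite eval≡linExt (p ++ q) v | eval≡linExt p v | eval≡linExt q v = linExt-++ _ p q

  eval-negP : ∀ {m} (p : Poly K m) v → eval K (negP p) v ≈ - eval K p v
  eval-negP p v rewrite eval≡linExt (negP p) v | eval≡linExt p v = linExt-negP _ p

  eval-⊗ : ∀ {m} (p q : Poly K m) v → eval K (_⊗_ K p q) v ≈ eval K p v * eval K q v
  eval-⊗ []            q v = sym (zeroˡ _)
  eval-⊗ ((x , a) ∷ p) q v = begin
    eval K (map (times (x , a)) q ++ _⊗_ K p q) v
      ≈⟨ eval-++ (map (times (x , a)) q) (_⊗_ K p q) v ⟩
    eval K (map (times (x , a)) q) v + eval K (_⊗_ K p q) v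
      ≈⟨ +-cong (eval-times q) (eval-⊗ p q v) ⟩
    (x * evalMon K a v) * eval K q v + eval K p v * eval K q v
      ≈⟨ sym (distribʳ _ _ _) ⟩
    (x * evalMon K a v + eval K p v) * eval K q v ∎
    where
    times : Carrier × Mon K _ → Carrier × Mon K _ → Carrier × Mon K _
    times t u = (proj₁ t * proj₁ u , zipWith _+ℕ_ (proj₂ t) (proj₂ u))
    eval-times : ∀ q → eval K (map (times (x , a)) q) v ≈ (x * evalMon K a v) * eval K q v
    eval-times []            = sym (zeroʳ _)
    eval-times ((y , b) ∷ q) =
      trans (+-cong (trans (*-congˡ (evalMon-zipWith a b v)) (interchange x y _ _)) (eval-times q))
            (sym (distribˡ _ _ _))

  eval-oneP : ∀ {m} v → eval K (oneP K {m}) v ≈ 1#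
  eval-oneP v = trans (+-identityʳ _) (trans (*-identityˡ _) (evalMon-replicate v))

  eval-constant : ∀ {m} x v → eval K ((x , replicate m 0) ∷ []) v ≈ x
  eval-constant x v = trans (+-identityʳ _) (trans (*-congˡ (evalMon-replicate v)) (*-identityʳ x))

  eval-powP : ∀ {m} (p : Poly K m) n v → eval K (powP K p n) v ≈ powK K (eval K p v) n
  eval-powP p zero    v = eval-oneP v
  eval-powP p (suc n) v = trans (eval-⊗ p (powP K p n) v) (*-congˡ (eval-powP p n v))

  eval-substMon : ∀ {m k} (L : Fin m → Poly K k) (a : Mon K m) v →
                  eval K (substMon K L a) v ≈ evalMonAt a (λ j → eval K (L j) v)
  eval-substMon {zero}  L []       v = eval-oneP v
  eval-substMon {suc m} L (a ∷ as) v =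
    trans (eval-⊗ (powP K (L Fin.zero) a) _ v)
          (*-cong (eval-powP (L Fin.zero) a v) (eval-substMon (λ j → L (Fin.suc j)) as v))

  eval-substP : ∀ {m k} (L : Fin m → Poly K k) (p : Poly K m) v →
                eval K (substP K L p) v ≈ evalAt p (λ j → eval K (L j) v)
  eval-substP L []            v = refl
  eval-substP L ((x , a) ∷ p) v = begin
    eval K (_⊗_ K const (substMon K L a) ++ substP K L p) v
      ≈⟨ eval-++ (_⊗_ K const (substMon K L a)) _ v ⟩
    eval K (_⊗_ K const (substMon K L a)) v + eval K (substP K L p) v
      ≈⟨ +-cong (trans (eval-⊗ const (substMon K L a) v) (*-cong (eval-constant x v) (eval-substMon L a v)))
                (eval-substP L p v) ⟩
    x * evalMonAt a (λ j → eval K (L j) v) + evalAt p (λ j → eval K (L j) v) ∎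
    where const = (x , replicate _ 0) ∷ []

  evalMonAt-cong : ∀ {m} (a : Mon K m) {f g : Fin m → Carrier} → (∀ i → f i ≈ g i) → evalMonAt a f ≈ evalMonAt a g
  evalMonAt-cong []       f≈g = refl
  evalMonAt-cong (a ∷ as) f≈g = *-cong (powK-cong a (f≈g Fin.zero)) (evalMonAt-cong as (λ i → f≈g (Fin.suc i)))

  evalAt-cong : ∀ {m} (p : Poly K m) {f g : Fin m → Carrier} → (∀ i → f i ≈ g i) → evalAt p f ≈ evalAt p g
  evalAt-cong []            f≈g = refl
  evalAt-cong ((x , a) ∷ p) f≈g = +-cong (*-congˡ (evalMonAt-cong a f≈g)) (evalAt-cong p f≈g)

  evalMonAt-unitMon : ∀ {m} (i : Fin m) f → evalMonAt (unitMon K i) f ≈ f i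
  evalMonAt-unitMon {suc m} Fin.zero f =
    trans (*-cong (*-identityʳ _) (evalMonAt-zero (λ i → f (Fin.suc i)))) (*-identityʳ _)
    where
    evalMonAt-zero : ∀ {m} (f : Fin m → Carrier) → evalMonAt (tabulate {n = m} (λ _ → 0)) f ≈ 1#
    evalMonAt-zero {zero}  f = refl
    evalMonAt-zero {suc m} f = trans (*-identityˡ _) (evalMonAt-zero (λ i → f (Fin.suc i)))
  evalMonAt-unitMon {suc m} (Fin.suc i) f = trans (*-identityˡ _) (evalMonAt-unitMon i (λ j → f (Fin.suc j)))

  evalAt-var : ∀ {m} (i : Fin m) f → evalAt (var K i) f ≈ f i
  evalAt-var i f = trans (+-identityʳ _) (trans (*-identityˡ _) (evalMonAt-unitMon i f))

  evalAt-act : ∀ {n} (g : Matrix K n) (p : Poly K n) f → evalAt (act K g p) f ≈ evalAt p (λ j → sum (λ i → g i j * f i))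
  evalAt-act {n} g p f = trans (eval-substP L p (tabulate f)) (evalAt-cong p eval-L)
    where
    L : Fin n → Poly K n
    L j = map (λ i → (g i j , unitMon K i)) (allFin n)
    eval-tabulate : ∀ {k} (F : Fin k → Carrier × Mon K n) →
                    eval K (List.tabulate F) (tabulate f) ≈ sum (λ i → proj₁ (F i) * evalMonAt (proj₂ (F i)) f)
    eval-tabulate {zero}  F = refl
    eval-tabulate {suc k} F = +-congˡ (eval-tabulate (λ i → F (Fin.suc i)))
    eval-L : ∀ j → eval K (L j) (tabulate f) ≈ sum (λ i → g i j * f i)
    eval-L j = begin
      eval K (L j) (tabulate f)
        ≡⟨ ≡.cong (λ q → eval K q (tabulate f)) (map-tabulate (λ i → i) (λ i → (g i j , unitMon K i))) ⟩
      eval K (List.tabulate (λ i → (g i j , unitMon K i))) (tabulate f)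
        ≈⟨ eval-tabulate (λ i → (g i j , unitMon K i)) ⟩
      sum (λ i → g i j * evalMonAt (unitMon K i) f)
        ≈⟨ sum-cong-≋ {n} (λ i → *-congˡ (evalMonAt-unitMon i f)) ⟩
      sum (λ i → g i j * f i) ∎

module GenericMatrices {c ℓ : Level} (K : Field c ℓ) where

  open Field K
  open FieldProperties K
  open FinSum K
  open Matrices K
  open LinearExtension K
  open Evaluation K
  open import Relation.Binary.Reasoning.Setoid setoid

  polyRawRing : ℕ → RawRing c ℓ
  polyRawRing m = record
    { Carrier = Poly K m ; _≈_ = _≃_ K ; _+_ = _⊕_ K ; _*_ = _⊗_ K ; -_ = negP ; 0# = zeroP K ; 1# = oneP K }

  eliminantᴷ-cong : ∀ {m} {M N : Matrix K m} → (∀ r c → M r c ≈ N r c) → eliminantᴷ M ≈ eliminantᴷ N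
  eliminantᴷ-cong {zero}  M≈N = refl
  eliminantᴷ-cong {suc m} M≈N = *-cong (M≈N Fin.zero Fin.zero) (eliminantᴷ-cong (λ r c →
    +-cong (*-cong (M≈N Fin.zero Fin.zero) (M≈N (Fin.suc r) (Fin.suc c)))
           (-‿cong (*-cong (M≈N (Fin.suc r) Fin.zero) (M≈N Fin.zero (Fin.suc c))))))

  eval-eliminant : ∀ {m k} (M : Fin m → Fin m → Poly K k) v →
                   eval K (eliminant (polyRawRing k) M) v ≈ eliminantᴷ (λ r c → eval K (M r c) v)
  eval-eliminant {zero}  M v = eval-oneP v
  eval-eliminant {suc m} M v =
    trans (eval-⊗ (M Fin.zero Fin.zero) _ v) (*-congˡ (trans (eval-eliminant (eliminationStep (polyRawRing _) M) v)
      (eliminantᴷ-cong (λ r c → trans (eval-++ (_⊗_ K (M Fin.zero Fin.zero) (M (Fin.suc r) (Fin.suc c))) _ v)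
        (+-cong (eval-⊗ (M Fin.zero Fin.zero) (M (Fin.suc r) (Fin.suc c)) v)
                (trans (eval-negP (_⊗_ K (M (Fin.suc r) Fin.zero) (M Fin.zero (Fin.suc c))) v)
                       (-‿cong (eval-⊗ (M (Fin.suc r) Fin.zero) (M Fin.zero (Fin.suc c)) v))))))))

  eval-product : ∀ {m k} (F : Fin m → Poly K k) v →
                 eval K (product (polyRawRing k) F) v ≈ product rawRing (λ i → eval K (F i) v)
  eval-product {zero}  F v = eval-oneP v
  eval-product {suc m} F v =
    trans (eval-⊗ (F Fin.zero) _ v) (*-congˡ (eval-product (λ i → F (Fin.suc i)) v))

  product-cong : ∀ {m} {F G : Fin m → Carrier} → (∀ i → F i ≈ G i) → product rawRing F ≈ product rawRing G
  product-cong {zero}  F≈G = refl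
  product-cong {suc m} F≈G = *-cong (F≈G Fin.zero) (product-cong (λ i → F≈G (Fin.suc i)))

  product≉0 : ∀ {m} (F : Fin m → Carrier) → ¬ (product rawRing F ≈ 0#) → ∀ i → ¬ (F i ≈ 0#)
  product≉0 F ∏≉0 Fin.zero    = x*y≉0⇒x≉0 ∏≉0
  product≉0 F ∏≉0 (Fin.suc i) = product≉0 (λ i → F (Fin.suc i)) (x*y≉0⇒y≉0 ∏≉0) i

  product≈1 : ∀ {m} (F : Fin m → Carrier) → (∀ i → F i ≈ 1#) → product rawRing F ≈ 1#
  product≈1 {zero}  F F≈1 = refl
  product≈1 {suc m} F F≈1 =
    trans (*-cong (F≈1 Fin.zero) (product≈1 (λ i → F (Fin.suc i)) (λ i → F≈1 (Fin.suc i)))) (*-identityˡ 1#)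

  entry : ∀ n → Fin n → Fin n → Poly K (n *ℕ n)
  entry n r c = var K (combine r c)

  eval-entry : ∀ {n} (g : Matrix K n) r c → eval K (entry n r c) (flatten K g) ≈ g r c
  eval-entry {n} g r c = trans (evalAt-var (combine r c) _)
    (≡.subst (λ rc → g (proj₁ rc) (proj₂ rc) ≈ g r c) (≡.sym (remQuot-combine r c)) refl)

  genericity : ∀ n → Poly K (suc n *ℕ suc n)
  genericity n = _⊗_ K (eliminant R (entry (suc n)))
                       (product R (λ i → eliminant R (cofactorMatrix (entry (suc n)) i)))
    where R = polyRawRing (suc n *ℕ suc n)

  eval-genericity : ∀ {n} (g : Matrix K (suc n)) →
                    eval K (genericity n) (flatten K g)
                      ≈ eliminantᴷ g * product rawRing (λ i → eliminantᴷ (cofactorMatrix g i))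
  eval-genericity {n} g =
    trans (eval-⊗ (eliminant R X) _ (flatten K g))
          (*-cong (trans (eval-eliminant X _) (eliminantᴷ-cong (eval-entry g)))
                  (trans (eval-product (λ i → eliminant R (cofactorMatrix X i)) (flatten K g))
                         (product-cong λ i → trans (eval-eliminant (cofactorMatrix X i) (flatten K g))
                                                   (eliminantᴷ-cong {n} λ p l →
                                                      eval-entry g (Fin.suc (cofactorRow i p)) (punchIn i l)))))
    where
    R = polyRawRing (suc n *ℕ suc n)
    X = entry (suc n)

  record Generic {n} (g : Matrix K (suc n)) : Set (c ⊔ ℓ) where
    field
      inv        : Matrix K (suc n)
      inv-right  : RightInverse g inv
      inv-left   : RightInverse inv g
      inv-col₀≉0 : ∀ i → ¬ (inv i Fin.zero ≈ 0#)

  rightInverse-·M : ∀ {n} {g h : Matrix K n} → (∀ i j → (_·M_ K g h) i j ≈ idM K i j) → RightInverse g h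
  rightInverse-·M {g = g} {h} gh≈1 i j = ≡.subst (_≈ δ i j) (sumF≡sum (λ k → g i k * h k j)) (gh≈1 i j)

  inOpen⇒generic : ∀ {n} (g : Matrix K (suc n)) → InOpen K (genericity n ∷ []) g → Generic g
  inOpen⇒generic {n} g ((h , gh≈1) , here P≉0) = record
    { inv        = h
    ; inv-right  = gh
    ; inv-left   = rightInverse⇒leftInverse g h gh (x*y≉0⇒x≉0 P≉0′)
    ; inv-col₀≉0 = λ i → cofactor≉0⇒inverse≉0 g h gh i
                           (product≉0 (λ i → eliminantᴷ (cofactorMatrix g i)) (x*y≉0⇒y≉0 P≉0′) i)
    }
    where
    gh = rightInverse-·M {g = g} {h} gh≈1
    P≉0′ : ¬ (eliminantᴷ g * product rawRing (λ i → eliminantᴷ (cofactorMatrix g i)) ≈ 0#)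
    P≉0′ P≈0 = P≉0 (trans (eval-genericity g) P≈0)

  oneP-nonempty : NonemptyOpen K {0} (oneP K ∷ [])
  oneP-nonempty = (λ ()) , ((λ ()) , λ ()) , here λ 1≈0 → 1≉0 (trans (sym (eval-oneP [])) 1≈0)

  genericity-nonempty : ∀ n → NonemptyOpen K {suc n} (genericity n ∷ [])
  genericity-nonempty n = g₀ , (witnessInverse , g₀-·M) , here P≉0
    where
    g₀ = witness {n}
    g₀-·M : ∀ i j → (_·M_ K g₀ witnessInverse) i j ≈ idM K i j
    g₀-·M i j = ≡.subst (_≈ δ i j) (≡.sym (sumF≡sum (λ k → g₀ i k * witnessInverse k j))) (witness-rightInverse i j)
    P≈1 : eval K (genericity n) (flatten K g₀) ≈ 1#
    P≈1 = begin
      eval K (genericity n) (flatten K g₀)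
        ≈⟨ eval-genericity g₀ ⟩
      eliminantᴷ g₀ * product rawRing (λ i → eliminantᴷ (cofactorMatrix g₀ i))
        ≈⟨ *-cong (lowerUnitriangular⇒eliminant≈1 g₀ witness-lowerUnitriangular)
                  (product≈1 (λ i → eliminantᴷ (cofactorMatrix g₀ i))
                             λ i → lowerUnitriangular⇒eliminant≈1 (cofactorMatrix g₀ i)
                                                                   (witness-cofactor-lowerUnitriangular i)) ⟩
      1# * 1#
        ≈⟨ *-identityˡ 1# ⟩
      1# ∎
    P≉0 : ¬ (eval K (genericity n) (flatten K g₀) ≈ 0#)
    P≉0 P≈0 = 1≉0 (trans (sym P≈1) P≈0)

module Monomials where

  open import Data.Nat using (_∸_)
  open import Data.Nat.Properties
  open import Relation.Binary.PropositionalEquality using (refl; cong; cong₂)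
  open import Algebra.Properties.CommutativeSemigroup +-commutativeSemigroup using (interchange)

  deg-zipWith : ∀ {m} (a b : Vec ℕ m) → deg (zipWith _+ℕ_ a b) ≡ deg a +ℕ deg b
  deg-zipWith []       []       = refl
  deg-zipWith (a ∷ as) (b ∷ bs) = ≡.trans (cong ((a +ℕ b) +ℕ_) (deg-zipWith as bs)) (interchange a b _ _)

  ∣ᵐ⇒deg≤ : ∀ {m} (b a : Vec ℕ m) → b ∣ᵐ a → deg b ≤ deg a
  ∣ᵐ⇒deg≤ []       []       b∣a = z≤n
  ∣ᵐ⇒deg≤ (b ∷ bs) (a ∷ as) b∣a = +-mono-≤ (b∣a Fin.zero) (∣ᵐ⇒deg≤ bs as (λ i → b∣a (Fin.suc i)))

  ∣ᵐ∧deg≡⇒≡ : ∀ {m} (b a : Vec ℕ m) → b ∣ᵐ a → deg b ≡ deg a → b ≡ a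
  ∣ᵐ∧deg≡⇒≡ []       []       _   _ = refl
  ∣ᵐ∧deg≡⇒≡ (b ∷ bs) (a ∷ as) b∣a e =
    cong₂ _∷_ b≡a (∣ᵐ∧deg≡⇒≡ bs as bs∣as (+-cancelˡ-≡ b _ _ (≡.trans e (cong (_+ℕ deg as) (≡.sym b≡a)))))
    where
    bs∣as : bs ∣ᵐ as
    bs∣as i = b∣a (Fin.suc i)
    b≡a : b ≡ a
    b≡a = ≤-antisym (b∣a Fin.zero)
            (+-cancelʳ-≤ (deg as) a b (≤-trans (≤-reflexive (≡.sym e)) (+-monoʳ-≤ b (∣ᵐ⇒deg≤ bs as bs∣as))))

  lookup≤deg : ∀ {m} (a : Vec ℕ m) k → lookup a k ≤ deg a
  lookup≤deg (a ∷ as) Fin.zero    = m≤m+n a (deg as)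
  lookup≤deg (a ∷ as) (Fin.suc k) = ≤-trans (lookup≤deg as k) (m≤n+m (deg as) a)

  deg≡0-unique : ∀ {m} (a b : Vec ℕ m) → deg a ≡ 0 → deg b ≡ 0 → a ≡ b
  deg≡0-unique []       []       _  _  = refl
  deg≡0-unique (a ∷ as) (b ∷ bs) ea eb = cong₂ _∷_ (≡.trans (m+n≡0⇒m≡0 a ea) (≡.sym (m+n≡0⇒m≡0 b eb)))
                                                    (deg≡0-unique as bs (m+n≡0⇒n≡0 a ea) (m+n≡0⇒n≡0 b eb))

  deg≡1⇒∃lookup≡1 : ∀ {m} (b : Vec ℕ m) → deg b ≡ 1 → Σ (Fin m) λ k → lookup b k ≡ 1
  deg≡1⇒∃lookup≡1 (zero ∷ bs) e with deg≡1⇒∃lookup≡1 bs e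
  ... | k , bₖ≡1 = Fin.suc k , bₖ≡1
  deg≡1⇒∃lookup≡1 (suc zero ∷ bs) e = Fin.zero , refl

  deg≡1-unique : ∀ {m} (a b : Vec ℕ m) k → deg a ≡ 1 → deg b ≡ 1 → lookup a k ≡ 1 → lookup b k ≡ 1 → a ≡ b
  deg≡1-unique (a ∷ as) (b ∷ bs) Fin.zero ea eb refl refl = cong (1 ∷_) (deg≡0-unique as bs (suc-injective ea) (suc-injective eb))
  deg≡1-unique (a ∷ as) (b ∷ bs) (Fin.suc k) ea eb aₖ≡1 bₖ≡1 =
    cong₂ _∷_ (≡.trans (head≡0 a as k ea aₖ≡1) (≡.sym (head≡0 b bs k eb bₖ≡1)))
              (deg≡1-unique as bs k (tail-deg a as k ea aₖ≡1) (tail-deg b bs k eb bₖ≡1) aₖ≡1 bₖ≡1)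
    where
    head≡0 : ∀ {m} x (xs : Vec ℕ m) k → x +ℕ deg xs ≡ 1 → lookup xs k ≡ 1 → x ≡ 0
    head≡0 x xs k e xₖ≡1 = n≤0⇒n≡0 (+-cancelʳ-≤ 1 x 0
      (≤-trans (+-monoʳ-≤ x (≤-trans (≤-reflexive (≡.sym xₖ≡1)) (lookup≤deg xs k))) (≤-reflexive e)))
    tail-deg : ∀ {m} x (xs : Vec ℕ m) k → x +ℕ deg xs ≡ 1 → lookup xs k ≡ 1 → deg xs ≡ 1
    tail-deg x xs k e xₖ≡1 = ≡.trans (cong (_+ℕ deg xs) (≡.sym (head≡0 x xs k e xₖ≡1))) e

  deg≡1⇒lookup≡0 : ∀ {m} (a : Vec ℕ m) k → deg a ≡ 1 → ¬ (lookup a k ≡ 1) → lookup a k ≡ 0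
  deg≡1⇒lookup≡0 a k e aₖ≢1 with n≤1⇒n≡0∨n≡1 (≤-trans (lookup≤deg a k) (≤-reflexive e))
  ... | inj₁ aₖ≡0 = aₖ≡0
  ... | inj₂ aₖ≡1 = ⊥-elim (aₖ≢1 aₖ≡1)

  divX₁ : ∀ {m} → Vec ℕ (suc m) → Vec ℕ (suc m)
  divX₁ (a ∷ as) = (a ∸ 1) ∷ as

  deg-divX₁ : ∀ {m} (a : Vec ℕ (suc m)) → 1 ≤ lookup a Fin.zero → suc (deg (divX₁ a)) ≡ deg a
  deg-divX₁ (suc a ∷ as) _ = refl

  divX₁-injective : ∀ {m} (a b : Vec ℕ (suc m)) → 1 ≤ lookup a Fin.zero → 1 ≤ lookup b Fin.zero →
                    divX₁ a ≡ divX₁ b → a ≡ b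
  divX₁-injective (suc a ∷ as) (suc b ∷ bs) _ _ refl = refl

  -- the monomials 1, x_k and x₁ x_k, i.e. the divisors of the x₁ x_k
  DividesSomeX₁Xₖ : ∀ {m} → Vec ℕ (suc m) → Set
  DividesSomeX₁Xₖ a = (deg a ≤ 2) × (deg a ≡ 2 → 1 ≤ lookup a Fin.zero)

  -- With x₁ the smallest variable, a quadric below x₁ x_k in ≺rev is still divisible by x₁.
  DividesSomeX₁Xₖ-≼rev : ∀ {m} (a b : Vec ℕ (suc m)) → DividesSomeX₁Xₖ b → a ≼rev b → DividesSomeX₁Xₖ a
  DividesSomeX₁Xₖ-≼rev a b divb (inj₁ refl) = divb
  DividesSomeX₁Xₖ-≼rev a b (degb≤2 , _) (inj₂ (inj₁ dega<degb)) =
    <⇒≤ (<-≤-trans dega<degb degb≤2) ,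
    λ dega≡2 → ⊥-elim (<-irrefl refl (<-≤-trans (≡.subst (_< deg b) dega≡2 dega<degb) degb≤2))
  DividesSomeX₁Xₖ-≼rev a b (degb≤2 , x₁∣b) (inj₂ (inj₂ (dega≡degb , i , agree , bᵢ<aᵢ))) =
    ≤-trans (≤-reflexive dega≡degb) degb≤2 ,
    λ dega≡2 → x₁∣a i agree bᵢ<aᵢ (x₁∣b (≡.trans (≡.sym dega≡degb) dega≡2))
    where
    x₁∣a : ∀ i → (∀ j → Fin._<_ j i → lookup a j ≡ lookup b j) → lookup b i < lookup a i →
           1 ≤ lookup b Fin.zero → 1 ≤ lookup a Fin.zero
    x₁∣a Fin.zero    _     b₀<a₀ _      = ≤-trans (s≤s z≤n) b₀<a₀
    x₁∣a (Fin.suc i) agree _     1≤b₀   = ≤-trans 1≤b₀ (≤-reflexive (≡.sym (agree Fin.zero (s≤s z≤n))))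

  module _ {c ℓ : Level} (K : Field c ℓ) where

    deg-unitMon : ∀ {m} (i : Fin m) → deg (unitMon K i) ≡ 1
    deg-unitMon {suc m} Fin.zero    = cong suc (deg-zeros m)
      where
      deg-zeros : ∀ m → deg (tabulate {n = m} (λ j → if does (Fin.zero {m} ≟ᶠ Fin.suc j) then 1 else 0)) ≡ 0
      deg-zeros zero    = refl
      deg-zeros (suc m) = deg-zeros m
    deg-unitMon {suc m} (Fin.suc i) = deg-unitMon i

    ∣x₁xⱼ⇒DividesSomeX₁Xₖ : ∀ {m} (j : Fin (suc m)) (b : Vec ℕ (suc m)) →
                             b ∣ᵐ zipWith _+ℕ_ (unitMon K Fin.zero) (unitMon K j) → DividesSomeX₁Xₖ b
    ∣x₁xⱼ⇒DividesSomeX₁Xₖ {m} j b b∣x₁xⱼ =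
      ≤-trans (∣ᵐ⇒deg≤ b x₁xⱼ b∣x₁xⱼ) (≤-reflexive deg≡2) ,
      λ degb≡2 → ≡.subst (λ v → 1 ≤ lookup v Fin.zero)
                         (≡.sym (∣ᵐ∧deg≡⇒≡ b x₁xⱼ b∣x₁xⱼ (≡.trans degb≡2 (≡.sym deg≡2))))
                         (x₁∣ (unitMon K j))
      where
      x₁xⱼ = zipWith _+ℕ_ (unitMon K Fin.zero) (unitMon K j)
      deg≡2 : deg x₁xⱼ ≡ 2
      deg≡2 = ≡.trans (deg-zipWith (unitMon K Fin.zero) (unitMon K j)) (cong₂ _+ℕ_ (deg-unitMon (Fin.zero {m})) (deg-unitMon j))
      x₁∣ : ∀ (v : Vec ℕ (suc m)) → 1 ≤ lookup (zipWith _+ℕ_ (unitMon K Fin.zero) v) Fin.zero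
      x₁∣ (v ∷ vs) = s≤s z≤n

open Monomials

module LineRestriction {c ℓ : Level} (K : Field c ℓ) where

  open Field K
  open FinSum K
  open LinearExtension K
  open Evaluation K
  open import Relation.Binary.Reasoning.Setoid setoid
  open import Algebra.Properties.CommutativeSemigroup *-commutativeSemigroup using (interchange)

  ofDegree : ∀ {m} → ℕ → Mon K m → Carrier → Carrier
  ofDegree d a x = if deg a ℕ.≡ᵇ d then x else 0#

  ofDegree-≡ : ∀ {m} d (a : Mon K m) x → deg a ≡ d → ofDegree d a x ≈ x
  ofDegree-≡ d a x dega≡d with deg a ℕ.≡ᵇ d | ≡⇒≡ᵇ (deg a) d dega≡d
  ... | true | _ = refl

  ofDegree-≢ : ∀ {m} d (a : Mon K m) x → ¬ (deg a ≡ d) → ofDegree d a x ≈ 0#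
  ofDegree-≢ d a x dega≢d with deg a ℕ.≡ᵇ d in eq
  ... | true  = ⊥-elim (dega≢d (≡ᵇ⇒≡ (deg a) d (≡.subst T (≡.sym eq) _)))
  ... | false = refl

  evalMonAt-scale : ∀ {m} (a : Mon K m) t w → evalMonAt a (λ c → t * w c) ≈ powK K t (deg a) * evalMonAt a w
  evalMonAt-scale []       t w = sym (*-identityˡ 1#)
  evalMonAt-scale (a ∷ as) t w = begin
    powK K (t * w Fin.zero) a * evalMonAt as (λ c → t * w (Fin.suc c))
      ≈⟨ *-cong (powK-* t _ a) (evalMonAt-scale as t (λ c → w (Fin.suc c))) ⟩
    (powK K t a * powK K (w Fin.zero) a) * (powK K t (deg as) * evalMonAt as (λ c → w (Fin.suc c)))
      ≈⟨ interchange _ _ _ _ ⟩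
    (powK K t a * powK K t (deg as)) * (powK K (w Fin.zero) a * evalMonAt as (λ c → w (Fin.suc c)))
      ≈⟨ *-congʳ (sym (powK-+ t a (deg as))) ⟩
    powK K t (a +ℕ deg as) * (powK K (w Fin.zero) a * evalMonAt as (λ c → w (Fin.suc c))) ∎

  evalMonAt-deg≡0 : ∀ {m} (a : Mon K m) w → deg a ≡ 0 → evalMonAt a w ≈ 1#
  evalMonAt-deg≡0 []          w _   = refl
  evalMonAt-deg≡0 (zero ∷ as) w deg≡0 = trans (*-identityˡ _) (evalMonAt-deg≡0 as (λ c → w (Fin.suc c)) deg≡0)

  linearForm : ∀ {m} → Mon K m → (Fin m → Carrier) → Carrier
  linearForm a w = sum (λ k → w k * natK K (lookup a k))

  linearForm-deg≡0 : ∀ {m} (a : Mon K m) w → deg a ≡ 0 → linearForm a w ≈ 0#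
  linearForm-deg≡0 []          w _     = refl
  linearForm-deg≡0 (zero ∷ as) w deg≡0 =
    trans (+-cong (zeroʳ _) (linearForm-deg≡0 as (λ c → w (Fin.suc c)) deg≡0)) (+-identityˡ 0#)

  evalMonAt-deg≡1 : ∀ {m} (a : Mon K m) w → deg a ≡ 1 → evalMonAt a w ≈ linearForm a w
  evalMonAt-deg≡1 (zero ∷ as) w deg≡1 = begin
    1# * evalMonAt as (λ c → w (Fin.suc c))       ≈⟨ *-identityˡ _ ⟩
    evalMonAt as (λ c → w (Fin.suc c))            ≈⟨ evalMonAt-deg≡1 as (λ c → w (Fin.suc c)) deg≡1 ⟩
    linearForm as (λ c → w (Fin.suc c))           ≈⟨ sym (+-identityˡ _) ⟩
    0# + linearForm as (λ c → w (Fin.suc c))      ≈⟨ +-congʳ (sym (zeroʳ _)) ⟩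
    w Fin.zero * 0# + linearForm as (λ c → w (Fin.suc c)) ∎
  evalMonAt-deg≡1 (suc zero ∷ as) w deg≡1 = begin
    (w Fin.zero * 1#) * evalMonAt as (λ c → w (Fin.suc c))
      ≈⟨ *-cong (*-identityʳ _) (evalMonAt-deg≡0 as _ deg≡0) ⟩
    w Fin.zero * 1#
      ≈⟨ *-congˡ (sym (+-identityʳ 1#)) ⟩
    w Fin.zero * (1# + 0#)
      ≈⟨ sym (+-identityʳ _) ⟩
    w Fin.zero * (1# + 0#) + 0#
      ≈⟨ +-congˡ (sym (linearForm-deg≡0 as _ deg≡0)) ⟩
    w Fin.zero * (1# + 0#) + linearForm as (λ c → w (Fin.suc c)) ∎
    where deg≡0 = suc-injective deg≡1

  evalMonAt-divX₁ : ∀ {m} (a : Mon K (suc m)) w → 1 ≤ lookup a Fin.zero →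
                    evalMonAt a w ≈ w Fin.zero * evalMonAt (divX₁ a) w
  evalMonAt-divX₁ (suc a ∷ as) w _ = *-assoc _ _ _

  term₀ : ∀ {m} → Mon K m → Carrier
  term₀ a = ofDegree 0 a 1#

  term₁ : ∀ {m} → (Fin m → Carrier) → Mon K m → Carrier
  term₁ w a = sum (λ k → w k * ofDegree 1 a (natK K (lookup a k)))

  term₂ : ∀ {m} → (Fin (suc m) → Carrier) → Mon K (suc m) → Carrier
  term₂ w a = w Fin.zero * sum (λ k → w k * ofDegree 2 a (natK K (lookup (divX₁ a) k)))

  term₁-deg≢1 : ∀ {m} w (a : Mon K m) → ¬ (deg a ≡ 1) → term₁ w a ≈ 0#
  term₁-deg≢1 {m} w a deg≢1 = sum-zero {m} (λ k → trans (*-congˡ (ofDegree-≢ 1 a (natK K (lookup a k)) deg≢1)) (zeroʳ (w k)))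

  term₂-deg≢2 : ∀ {m} w (a : Mon K (suc m)) → ¬ (deg a ≡ 2) → term₂ w a ≈ 0#
  term₂-deg≢2 {m} w a deg≢2 =
    trans (*-congˡ (sum-zero {suc m} λ k →
             trans (*-congˡ (ofDegree-≢ 2 a (natK K (lookup (divX₁ a) k)) deg≢2)) (zeroʳ (w k))))
          (zeroʳ _)

  term₁-deg≡1 : ∀ {m} w (a : Mon K m) → deg a ≡ 1 → term₁ w a ≈ linearForm a w
  term₁-deg≡1 {m} w a deg≡1 = sum-cong-≋ {m} (λ k → *-congˡ {w k} (ofDegree-≡ 1 a (natK K (lookup a k)) deg≡1))

  term₂-deg≡2 : ∀ {m} w (a : Mon K (suc m)) → deg a ≡ 2 → term₂ w a ≈ w Fin.zero * linearForm (divX₁ a) w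
  term₂-deg≡2 {m} w a deg≡2 =
    *-congˡ (sum-cong-≋ {suc m} λ k → *-congˡ {w k} (ofDegree-≡ 2 a (natK K (lookup (divX₁ a) k)) deg≡2))

  private
    ≤2-cases : ∀ {d} → d ≤ 2 → (d ≡ 0) ⊎ (d ≡ 1) ⊎ (d ≡ 2)
    ≤2-cases z≤n             = inj₁ ≡.refl
    ≤2-cases (s≤s z≤n)       = inj₂ (inj₁ ≡.refl)
    ≤2-cases (s≤s (s≤s z≤n)) = inj₂ (inj₂ ≡.refl)

    deg≢ : ∀ {x d d′ : ℕ} → x ≡ d → ¬ (d ≡ d′) → ¬ (x ≡ d′)
    deg≢ ≡.refl d≢d′ = d≢d′

  quadratic : Carrier → Carrier → Carrier → Carrier → Carrier
  quadratic e₀ e₁ e₂ t = e₀ + (t * e₁ + powK K t 2 * e₂)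

  quadratic-cong : ∀ {e₀ e₁ e₂ f₀ f₁ f₂} → e₀ ≈ f₀ → e₁ ≈ f₁ → e₂ ≈ f₂ → ∀ t → quadratic e₀ e₁ e₂ t ≈ quadratic f₀ f₁ f₂ t
  quadratic-cong e₀≈f₀ e₁≈f₁ e₂≈f₂ t = +-cong e₀≈f₀ (+-cong (*-congˡ e₁≈f₁) (*-congˡ e₂≈f₂))

  quadratic-constant : ∀ e t → quadratic e 0# 0# t ≈ e
  quadratic-constant e t = trans (+-congˡ (trans (+-cong (zeroʳ t) (zeroʳ _)) (+-identityˡ 0#))) (+-identityʳ e)

  quadratic-linear : ∀ e t → quadratic 0# e 0# t ≈ t * e
  quadratic-linear e t = trans (+-identityˡ _) (trans (+-congˡ (zeroʳ _)) (+-identityʳ _))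

  quadratic-square : ∀ e t → quadratic 0# 0# e t ≈ powK K t 2 * e
  quadratic-square e t = trans (+-identityˡ _) (trans (+-congʳ (zeroʳ t)) (+-identityˡ _))

  evalMonAt-line : ∀ {m} (a : Mon K (suc m)) → DividesSomeX₁Xₖ a → ∀ t w →
                   evalMonAt a (λ c → t * w c) ≈ quadratic (term₀ a) (term₁ w a) (term₂ w a) t
  evalMonAt-line a (deg≤2 , x₁∣a) t w with ≤2-cases deg≤2
  ... | inj₁ deg≡0 = begin
    evalMonAt a (λ c → t * w c)       ≈⟨ evalMonAt-scale a t w ⟩
    powK K t (deg a) * evalMonAt a w  ≡⟨ ≡.cong (λ d → powK K t d * evalMonAt a w) deg≡0 ⟩
    1# * evalMonAt a w                ≈⟨ trans (*-identityˡ _) (evalMonAt-deg≡0 a w deg≡0) ⟩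
    1#                                ≈⟨ sym (quadratic-constant 1# t) ⟩
    quadratic 1# 0# 0# t              ≈⟨ sym (quadratic-cong (ofDegree-≡ 0 a 1# deg≡0)
                                                             (term₁-deg≢1 w a (deg≢ deg≡0 λ ()))
                                                             (term₂-deg≢2 w a (deg≢ deg≡0 λ ())) t) ⟩
    quadratic (term₀ a) (term₁ w a) (term₂ w a) t ∎
  ... | inj₂ (inj₁ deg≡1) = begin
    evalMonAt a (λ c → t * w c)       ≈⟨ evalMonAt-scale a t w ⟩
    powK K t (deg a) * evalMonAt a w  ≡⟨ ≡.cong (λ d → powK K t d * evalMonAt a w) deg≡1 ⟩
    (t * 1#) * evalMonAt a w          ≈⟨ *-cong (*-identityʳ t) (evalMonAt-deg≡1 a w deg≡1) ⟩
    t * linearForm a w                ≈⟨ sym (quadratic-linear _ t) ⟩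
    quadratic 0# (linearForm a w) 0# t ≈⟨ sym (quadratic-cong (ofDegree-≢ 0 a 1# (deg≢ deg≡1 λ ()))
                                                              (term₁-deg≡1 w a deg≡1)
                                                              (term₂-deg≢2 w a (deg≢ deg≡1 λ ())) t) ⟩
    quadratic (term₀ a) (term₁ w a) (term₂ w a) t ∎
  ... | inj₂ (inj₂ deg≡2) = begin
    evalMonAt a (λ c → t * w c)       ≈⟨ evalMonAt-scale a t w ⟩
    powK K t (deg a) * evalMonAt a w  ≡⟨ ≡.cong (λ d → powK K t d * evalMonAt a w) deg≡2 ⟩
    powK K t 2 * evalMonAt a w        ≈⟨ *-congˡ (trans (evalMonAt-divX₁ a w x₁∣a′)
                                                         (*-congˡ (evalMonAt-deg≡1 (divX₁ a) w deg-a/x₁≡1))) ⟩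
    powK K t 2 * (w Fin.zero * linearForm (divX₁ a) w)
                                      ≈⟨ sym (quadratic-square _ t) ⟩
    quadratic 0# 0# (w Fin.zero * linearForm (divX₁ a) w) t
                                      ≈⟨ sym (quadratic-cong (ofDegree-≢ 0 a 1# (deg≢ deg≡2 λ ()))
                                                             (term₁-deg≢1 w a (deg≢ deg≡2 λ ()))
                                                             (term₂-deg≡2 w a deg≡2) t) ⟩
    quadratic (term₀ a) (term₁ w a) (term₂ w a) t ∎
    where
    x₁∣a′ = x₁∣a deg≡2
    deg-a/x₁≡1 = suc-injective (≡.trans (deg-divX₁ a x₁∣a′) deg≡2)

  constantCoeff : ∀ {m} → Poly K m → Carrier
  constantCoeff f = linExt term₀ f

  linearCoeff : ∀ {m} → Poly K m → Fin m → Carrier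
  linearCoeff f k = linExt (λ a → ofDegree 1 a (natK K (lookup a k))) f

  quadraticCoeff : ∀ {m} → Poly K (suc m) → Fin (suc m) → Carrier
  quadraticCoeff f k = linExt (λ a → ofDegree 2 a (natK K (lookup (divX₁ a) k))) f

  linExt-term₁ : ∀ {m} w (f : Poly K m) → linExt (term₁ w) f ≈ sum (λ k → w k * linearCoeff f k)
  linExt-term₁ {m} w f =
    trans (linExt-sum (λ a k → w k * ofDegree 1 a (natK K (lookup a k))) f)
          (sum-cong-≋ {m} (λ k → linExt-*ˡ (w k) (λ a → ofDegree 1 a (natK K (lookup a k))) f))

  linExt-term₂ : ∀ {m} w (f : Poly K (suc m)) → linExt (term₂ w) f ≈ w Fin.zero * sum (λ k → w k * quadraticCoeff f k)
  linExt-term₂ {m} w f =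
    trans (linExt-*ˡ (w Fin.zero) _ f)
          (*-congˡ (trans (linExt-sum (λ a k → w k * ofDegree 2 a (natK K (lookup (divX₁ a) k))) f)
                          (sum-cong-≋ {suc m} (λ k → linExt-*ˡ (w k) (λ a → ofDegree 2 a (natK K (lookup (divX₁ a) k))) f))))

  evalAt-line : ∀ {m} (f : Poly K (suc m)) → (∀ a → ¬ (coeff K f a ≈ 0#) → DividesSomeX₁Xₖ a) → ∀ t w →
                ¬ ¬ (evalAt f (λ c → t * w c)
                     ≈ quadratic (constantCoeff f) (sum (λ k → w k * linearCoeff f k))
                                 (w Fin.zero * sum (λ k → w k * quadraticCoeff f k)) t)
  evalAt-line f supp t w ≉ =
    linExt-onSupport f (λ a → evalMonAt a (λ c → t * w c)) line (λ a c≉0 → evalMonAt-line a (supp a c≉0) t w) λ e →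
      ≉ (begin
        evalAt f (λ c → t * w c)
          ≡⟨ eval≡linExt f _ ⟩
        linExt (λ a → evalMonAt a (λ c → t * w c)) f
          ≈⟨ e ⟩
        linExt line f
          ≈⟨ linExt-+ term₀ _ f ⟩
        constantCoeff f + linExt (λ a → t * term₁ w a + powK K t 2 * term₂ w a) f
          ≈⟨ +-congˡ (linExt-+ (λ a → t * term₁ w a) _ f) ⟩
        constantCoeff f + (linExt (λ a → t * term₁ w a) f + linExt (λ a → powK K t 2 * term₂ w a) f)
          ≈⟨ +-congˡ (+-cong (trans (linExt-*ˡ t (term₁ w) f) (*-congˡ (linExt-term₁ w f)))
                             (trans (linExt-*ˡ (powK K t 2) (term₂ w) f) (*-congˡ (linExt-term₂ w f)))) ⟩
        constantCoeff f + (t * sum (λ k → w k * linearCoeff f k)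
                           + powK K t 2 * (w Fin.zero * sum (λ k → w k * quadraticCoeff f k))) ∎)
    where
    line : Mon K _ → Carrier
    line a = term₀ a + (t * term₁ w a + powK K t 2 * term₂ w a)

  quadratic-vanishes-at-0,±1 : ¬ (1# + 1# ≈ 0#) → ∀ e₀ e₁ e₂ →
    quadratic e₀ e₁ e₂ 0# ≈ 0# → quadratic e₀ e₁ e₂ 1# ≈ 0# → quadratic e₀ e₁ e₂ (- 1#) ≈ 0# →
    (e₀ ≈ 0#) × (e₁ ≈ 0#) × (e₂ ≈ 0#)
  quadratic-vanishes-at-0,±1 2≉0 e₀ e₁ e₂ q[0]≈0 q[1]≈0 q[-1]≈0 = e₀≈0 , e₁≈0 , e₂≈0
    where
    open import Algebra.Properties.Ring ring using (-1*x≈-x)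
    open import Algebra.Properties.Group +-group using (⁻¹-involutive)
    open FieldProperties K using (x≉0∧x*y≈0⇒y≈0)
    1²≈1 : powK K 1# 2 ≈ 1#
    1²≈1 = trans (*-identityˡ _) (*-identityˡ _)
    [-1]²≈1 : powK K (- 1#) 2 ≈ 1#
    [-1]²≈1 = trans (*-congˡ (*-identityʳ _)) (trans (-1*x≈-x (- 1#)) (⁻¹-involutive 1#))
    e₀≈0 : e₀ ≈ 0#
    e₀≈0 = begin
      e₀                          ≈⟨ sym (+-identityʳ e₀) ⟩
      e₀ + 0#                     ≈⟨ +-congˡ (sym (trans (+-cong (zeroˡ e₁) (trans (*-congʳ (zeroˡ _)) (zeroˡ e₂)))
                                                        (+-identityˡ 0#))) ⟩
      quadratic e₀ e₁ e₂ 0#       ≈⟨ q[0]≈0 ⟩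
      0#                          ∎
    e₁+e₂≈0 : e₁ + e₂ ≈ 0#
    e₁+e₂≈0 = begin
      e₁ + e₂                   ≈⟨ sym (+-identityˡ _) ⟩
      0# + (e₁ + e₂)            ≈⟨ sym (+-cong e₀≈0 (+-cong (*-identityˡ e₁) (trans (*-congʳ 1²≈1) (*-identityˡ e₂)))) ⟩
      quadratic e₀ e₁ e₂ 1#     ≈⟨ q[1]≈0 ⟩
      0#                        ∎
    -e₁+e₂≈0 : - e₁ + e₂ ≈ 0#
    -e₁+e₂≈0 = begin
      - e₁ + e₂                 ≈⟨ sym (+-identityˡ _) ⟩
      0# + (- e₁ + e₂)          ≈⟨ sym (+-cong e₀≈0 (+-cong (-1*x≈-x e₁) (trans (*-congʳ [-1]²≈1) (*-identityˡ e₂)))) ⟩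
      quadratic e₀ e₁ e₂ (- 1#) ≈⟨ q[-1]≈0 ⟩
      0#                        ∎
    e₂≈0 : e₂ ≈ 0#
    e₂≈0 = x≉0∧x*y≈0⇒y≈0 2≉0 (begin
      (1# + 1#) * e₂                 ≈⟨ trans (distribʳ e₂ 1# 1#) (+-cong (*-identityˡ e₂) (*-identityˡ e₂)) ⟩
      e₂ + e₂                        ≈⟨ sym (+-identityˡ _) ⟩
      0# + (e₂ + e₂)                 ≈⟨ +-congʳ (sym (-‿inverseʳ e₁)) ⟩
      (e₁ + - e₁) + (e₂ + e₂)        ≈⟨ +-interchange e₁ (- e₁) e₂ e₂ ⟩
      (e₁ + e₂) + (- e₁ + e₂)        ≈⟨ +-cong e₁+e₂≈0 -e₁+e₂≈0 ⟩
      0# + 0#                        ≈⟨ +-identityˡ 0# ⟩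
      0#                             ∎)
      where open import Algebra.Properties.CommutativeSemigroup +-commutativeSemigroup renaming (interchange to +-interchange)
    e₁≈0 : e₁ ≈ 0#
    e₁≈0 = trans (sym (+-identityʳ e₁)) (trans (+-congˡ (sym e₂≈0)) e₁+e₂≈0)

  private
    natK-1 : natK K 1 ≈ 1#
    natK-1 = +-identityʳ 1#

  indicator-deg≡0 : ∀ {m} (b : Mon K m) → deg b ≡ 0 → ∀ a → indicator b a ≈ term₀ a
  indicator-deg≡0 b degb≡0 a with ≡-dec ℕ._≟_ a b
  ... | yes ≡.refl = sym (ofDegree-≡ 0 a 1# degb≡0)
  ... | no  a≢b    = sym (ofDegree-≢ 0 a 1# λ dega≡0 → a≢b (deg≡0-unique a b dega≡0 degb≡0))

  indicator-deg≡1 : ∀ {m} (b : Mon K m) k → deg b ≡ 1 → lookup b k ≡ 1 →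
                    ∀ a → indicator b a ≈ ofDegree 1 a (natK K (lookup a k))
  indicator-deg≡1 b k degb≡1 bₖ≡1 a with ≡-dec ℕ._≟_ a b
  ... | yes ≡.refl = sym (trans (ofDegree-≡ 1 a _ degb≡1) (trans (reflexive (≡.cong (natK K) bₖ≡1)) natK-1))
  ... | no  a≢b with deg a ℕ.≟ 1
  ...   | no  dega≢1 = sym (ofDegree-≢ 1 a _ dega≢1)
  ...   | yes dega≡1 = sym (trans (ofDegree-≡ 1 a _ dega≡1)
                         (reflexive (≡.cong (natK K) (deg≡1⇒lookup≡0 a k dega≡1 λ aₖ≡1 →
                           a≢b (deg≡1-unique a b k dega≡1 degb≡1 aₖ≡1 bₖ≡1)))))

  indicator-deg≡2 : ∀ {m} (b : Mon K (suc m)) k → DividesSomeX₁Xₖ b → deg b ≡ 2 → lookup (divX₁ b) k ≡ 1 →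
                    ∀ a → DividesSomeX₁Xₖ a → indicator b a ≈ ofDegree 2 a (natK K (lookup (divX₁ a) k))
  indicator-deg≡2 b k (_ , x₁∣b) degb≡2 bₖ≡1 a (_ , x₁∣a) with ≡-dec ℕ._≟_ a b
  ... | yes ≡.refl = sym (trans (ofDegree-≡ 2 a _ degb≡2) (trans (reflexive (≡.cong (natK K) bₖ≡1)) natK-1))
  ... | no  a≢b with deg a ℕ.≟ 2
  ...   | no  dega≢2 = sym (ofDegree-≢ 2 a _ dega≢2)
  ...   | yes dega≡2 = sym (trans (ofDegree-≡ 2 a _ dega≡2) (reflexive (≡.cong (natK K)
                         (deg≡1⇒lookup≡0 (divX₁ a) k (deg-divX₁≡1 a (x₁∣a dega≡2) dega≡2) λ aₖ≡1 →
                           a≢b (divX₁-injective a b (x₁∣a dega≡2) (x₁∣b degb≡2)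
                                 (deg≡1-unique (divX₁ a) (divX₁ b) k (deg-divX₁≡1 a (x₁∣a dega≡2) dega≡2)
                                               (deg-divX₁≡1 b (x₁∣b degb≡2) degb≡2) aₖ≡1 bₖ≡1))))))
    where
    deg-divX₁≡1 : ∀ a → 1 ≤ lookup a Fin.zero → deg a ≡ 2 → deg (divX₁ a) ≡ 1
    deg-divX₁≡1 a x₁∣a dega≡2 = suc-injective (≡.trans (deg-divX₁ a x₁∣a) dega≡2)

  -- On the support of f, the coefficient of 1, x_k or x₁x_k is the constant,
  -- linear or quadratic coefficient along x_k.
  lineCoeffs≈0⇒coeff≈0 : ∀ {m} (f : Poly K (suc m)) → (∀ a → ¬ (coeff K f a ≈ 0#) → DividesSomeX₁Xₖ a) →
    constantCoeff f ≈ 0# → (∀ k → linearCoeff f k ≈ 0#) → (∀ k → quadraticCoeff f k ≈ 0#) →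
    ∀ b → DividesSomeX₁Xₖ b → ¬ ¬ (coeff K f b ≈ 0#)
  lineCoeffs≈0⇒coeff≈0 f supp c₀≈0 c₁≈0 c₂≈0 b divb@(degb≤2 , x₁∣b) ≉ with ≤2-cases degb≤2
  ... | inj₁ degb≡0 = ≉ (trans (sym (linExt-indicator f b)) (trans (linExt-cong (indicator-deg≡0 b degb≡0) f) c₀≈0))
  ... | inj₂ (inj₁ degb≡1) with deg≡1⇒∃lookup≡1 b degb≡1
  ...   | k , bₖ≡1 = ≉ (trans (sym (linExt-indicator f b)) (trans (linExt-cong (indicator-deg≡1 b k degb≡1 bₖ≡1) f) (c₁≈0 k)))
  lineCoeffs≈0⇒coeff≈0 f supp c₀≈0 c₁≈0 c₂≈0 b divb@(degb≤2 , x₁∣b) ≉ | inj₂ (inj₂ degb≡2)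
    with deg≡1⇒∃lookup≡1 (divX₁ b) (suc-injective (≡.trans (deg-divX₁ b (x₁∣b degb≡2)) degb≡2))
  ...   | k , bₖ≡1 = linExt-onSupport f (indicator b) _ (λ a c≉0 → indicator-deg≡2 b k divb degb≡2 bₖ≡1 a (supp a c≉0)) λ e →
                       ≉ (trans (sym (linExt-indicator f b)) (trans e (c₂≈0 k)))

¬¬-∀Fin : ∀ {p m} {P : Fin m → Set p} → (∀ i → ¬ ¬ P i) → ¬ ¬ (∀ i → P i)
¬¬-∀Fin {m = zero}  ¬¬P k = k (λ ())
¬¬-∀Fin {m = suc m} ¬¬P k = ¬¬P Fin.zero λ P₀ → ¬¬-∀Fin (λ i → ¬¬P (Fin.suc i)) λ Pₛ →
  k λ where Fin.zero    → P₀
            (Fin.suc i) → Pₛ i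

module AxesVanishing {c ℓ : Level} (K : Field c ℓ) where

  open Field K
  open FinSum K
  open Evaluation K

  axisPoint : ∀ {N} → Fin N → Carrier → Fin N → Carrier
  axisPoint i t c = t * δ i c

  evalAt-var-axisPoint : ∀ {N} {i q : Fin N} t → ¬ (i ≡ q) → evalAt (var K q) (axisPoint i t) ≈ 0#
  evalAt-var-axisPoint {i = i} {q} t i≢q = trans (evalAt-var q (axisPoint i t)) (trans (*-congˡ (δ-offDiag i≢q)) (zeroʳ t))

  evalAt-xₐxᵦ-axisPoint : ∀ {N} (i : Fin N) t {a b : Fin N} → ¬ (a ≡ b) →
                          evalAt (_⊗_ K (var K a) (var K b)) (axisPoint i t) ≈ 0#
  evalAt-xₐxᵦ-axisPoint i t {a} {b} a≢b with i ≟ᶠ a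
  ... | yes ≡.refl = trans (eval-⊗ (var K a) (var K b) _) (trans (*-congˡ (evalAt-var-axisPoint t a≢b)) (zeroʳ _))
  ... | no  i≢a    = trans (eval-⊗ (var K a) (var K b) _) (trans (*-congʳ (evalAt-var-axisPoint t i≢a)) (zeroˡ _))

  private
    <⇒≢ᶠ : ∀ {N} {a b : Fin N} → toℕ a < toℕ b → ¬ (a ≡ b)
    <⇒≢ᶠ a<b a≡b = <⇒≢ a<b (≡.cong toℕ a≡b)

  IGgen-vanishes-on-axes : ∀ {N} (G : Graph N) q → IGgen K G q → ∀ i t → evalAt q (axisPoint i t) ≈ 0#
  IGgen-vanishes-on-axes G q (inj₁ (a , b , a<b , _ , ≡.refl)) i t = evalAt-xₐxᵦ-axisPoint i t (<⇒≢ᶠ a<b)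
  IGgen-vanishes-on-axes G q (inj₂ (a , b , d , a<b , _ , ≡.refl)) i t =
    trans (eval-⊗ (_⊗_ K (var K a) (var K b)) (var K d) _)
          (trans (*-congʳ (evalAt-xₐxᵦ-axisPoint i t (<⇒≢ᶠ a<b))) (zeroˡ _))

  combination-vanishes-on-axes : ∀ {N} (G : Graph N) (hs : List (Poly K N × Poly K N)) →
    All (λ hq → IGgen K G (proj₂ hq)) hs → ∀ i t →
    evalAt (sumP K (map (λ hq → _⊗_ K (proj₁ hq) (proj₂ hq)) hs)) (axisPoint i t) ≈ 0#
  combination-vanishes-on-axes G []             []           i t = refl
  combination-vanishes-on-axes G ((p , q) ∷ hs) (gen-q ∷ gens) i t =
    trans (eval-++ (_⊗_ K p q) _ (tabulate (axisPoint i t)))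
      (trans (+-cong (trans (eval-⊗ p q _) (trans (*-congˡ (IGgen-vanishes-on-axes G q gen-q i t)) (zeroʳ _)))
                     (combination-vanishes-on-axes G hs gens i t))
             (+-identityˡ 0#))

module InitialIdeal {c ℓ : Level} (K : Field c ℓ) (char0 : CharZero K) where

  open Field K
  open FieldProperties K
  open FinSum K
  open Matrices K
  open LinearExtension K
  open Evaluation K
  open GenericMatrices K
  open LineRestriction K
  open AxesVanishing K
  open import Relation.Binary.Reasoning.Setoid setoid
  open import Algebra.Properties.CommutativeSemigroup *-commutativeSemigroup using (x∙yz≈y∙xz)

  -- The rows of g⁻¹ are mapped by gᵀ onto the coordinate axes, on which I_G vanishes.
  actIdeal-vanishes-on-lines : ∀ {n} (G : Graph n) (g h : Matrix K n) → RightInverse h g →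
    ∀ f → ActIdeal K g (IG K G) f → ∀ i t → ¬ ¬ (evalAt f (λ c → t * h i c) ≈ 0#)
  actIdeal-vanishes-on-lines {n} G g h hg≈1 f (f₀ , (hs , gens , f₀≃S) , f≃gf₀) i t ≉ =
    linExt-≃ {p = f} {act K g f₀} f≃gf₀ (λ a → evalMonAt a v) λ f≈gf₀ →
    linExt-≃ {p = f₀} {S} f₀≃S (λ a → evalMonAt a (axisPoint i t)) λ f₀≈S →
    ≉ (begin
      evalAt f v                        ≡⟨ eval≡linExt f _ ⟩
      linExt (λ a → evalMonAt a v) f    ≈⟨ f≈gf₀ ⟩
      linExt (λ a → evalMonAt a v) (act K g f₀) ≡⟨ ≡.sym (eval≡linExt (act K g f₀) _) ⟩
      evalAt (act K g f₀) v             ≈⟨ evalAt-act g f₀ v ⟩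
      evalAt f₀ (λ j → sum (λ c → g c j * v c)) ≈⟨ evalAt-cong f₀ gᵀv≈axisPoint ⟩
      evalAt f₀ (axisPoint i t)         ≡⟨ eval≡linExt f₀ _ ⟩
      linExt (λ a → evalMonAt a (axisPoint i t)) f₀ ≈⟨ f₀≈S ⟩
      linExt (λ a → evalMonAt a (axisPoint i t)) S  ≡⟨ ≡.sym (eval≡linExt S _) ⟩
      evalAt S (axisPoint i t)          ≈⟨ combination-vanishes-on-axes G hs gens i t ⟩
      0#                                ∎)
    where
    S = sumP K (map (λ hq → _⊗_ K (proj₁ hq) (proj₂ hq)) hs)
    v : Fin n → Carrier
    v c = t * h i c
    gᵀv≈axisPoint : ∀ j → sum (λ c → g c j * v c) ≈ axisPoint i t j
    gᵀv≈axisPoint j = begin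
      sum (λ c → g c j * (t * h i c)) ≈⟨ sum-cong-≋ {n} (λ c → trans (x∙yz≈y∙xz (g c j) t _) (*-congˡ (*-comm (g c j) _))) ⟩
      sum (λ c → t * (h i c * g c j)) ≈⟨ sym (*-distribˡ-sum {n} t _) ⟩
      t * sum (λ c → h i c * g c j)   ≈⟨ *-congˡ (hg≈1 i j) ⟩
      t * δ i j                       ∎

  1+1≉0 : ¬ (1# + 1# ≈ 0#)
  1+1≉0 2≈0 = char0 1 (trans (+-congˡ (+-identityʳ 1#)) 2≈0)

  x₁xⱼ∉initial : ∀ {n} (g : Matrix K (suc n)) → Generic g → (G : Graph (suc n)) (j : Fin (suc n)) →
                 ¬ InInitial K (ActIdeal K g (IG K G)) (zipWith _+ℕ_ (unitMon K Fin.zero) (unitMon K j))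
  x₁xⱼ∉initial {n} g gen G j (f , f∈gI , b , (fb≉0 , b-lead) , b∣x₁xⱼ) =
    ¬¬-∀Fin lineCoeffs≈0 λ rows →
      lineCoeffs≈0⇒coeff≈0 f supp
        (proj₂ (proj₂ (rows Fin.zero)))
        (rightInverse⇒injective g h inv-right (linearCoeff f) (λ i → proj₁ (rows i)))
        (rightInverse⇒injective g h inv-right (quadraticCoeff f) (λ i → proj₁ (proj₂ (rows i))))
        b divb fb≉0
    where
    open Generic gen renaming (inv to h)
    divb : DividesSomeX₁Xₖ b
    divb = ∣x₁xⱼ⇒DividesSomeX₁Xₖ K j b b∣x₁xⱼ
    supp : ∀ a → ¬ (coeff K f a ≈ 0#) → DividesSomeX₁Xₖ a
    supp a fa≉0 = DividesSomeX₁Xₖ-≼rev a b divb (b-lead a fa≉0)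
    LineCoeffs≈0 : Fin (suc n) → Set ℓ
    LineCoeffs≈0 i = (sum (λ k → h i k * linearCoeff f k) ≈ 0#)
                   × (sum (λ k → h i k * quadraticCoeff f k) ≈ 0#)
                   × (constantCoeff f ≈ 0#)
    lineCoeffs≈0 : ∀ i → ¬ ¬ LineCoeffs≈0 i
    lineCoeffs≈0 i ≉ = vanishesAt 0# λ q[0]≈0 → vanishesAt 1# λ q[1]≈0 → vanishesAt (- 1#) λ q[-1]≈0 →
      ≉ (conclude (quadratic-vanishes-at-0,±1 1+1≉0 _ _ _ q[0]≈0 q[1]≈0 q[-1]≈0))
      where
      e₁ = sum (λ k → h i k * linearCoeff f k)
      e₂ = sum (λ k → h i k * quadraticCoeff f k)
      vanishesAt : ∀ t → ¬ ¬ (quadratic (constantCoeff f) e₁ (h i Fin.zero * e₂) t ≈ 0#)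
      vanishesAt t ≉ = evalAt-line f supp t (h i) λ line →
        actIdeal-vanishes-on-lines G g h inv-left f f∈gI i t λ f≈0 → ≉ (trans (sym line) f≈0)
      conclude : (constantCoeff f ≈ 0#) × (e₁ ≈ 0#) × (h i Fin.zero * e₂ ≈ 0#) → LineCoeffs≈0 i
      conclude (c≈0 , e₁≈0 , he₂≈0) = e₁≈0 , x≉0∧x*y≈0⇒y≈0 (inv-col₀≉0 i) he₂≈0 , c≈0

module Counting where

  open import Data.Nat using (_+_; _∸_)
  open import Data.Nat.Properties using (<-irrefl; +-comm; +-identityʳ; ≤-reflexive; m∸n≤m; <-≤-trans)
  open import Data.Fin using (inject₁; fromℕ)
  open import Data.Fin.Properties using (toℕ-inject₁; toℕ-fromℕ; toℕ-injective)
  open import Data.List using (concatMap)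
  open import Data.List.Properties using (map-cong)
  open import Function.Bundles using (_⇔_; mk⇔; Equivalence)
  open import Function.Properties.Equivalence using () renaming (trans to ⇔-trans)
  open import Relation.Nullary using (Dec)
  open import Relation.Nullary.Decidable using (dec-true; dec-false; does-⇔)
  open import Relation.Binary.PropositionalEquality using (refl; cong; cong₂)
  open import Algebra.Properties.CommutativeMonoid.Sum Data.Nat.Properties.+-0-commutativeMonoid
    using (sum; sum-init-last; sum-cong-≗)

  countTrue-++ : ∀ (xs ys : List Bool) → countTrue (xs ++ ys) ≡ countTrue xs + countTrue ys
  countTrue-++ []           ys = refl
  countTrue-++ (true ∷ xs)  ys = cong suc (countTrue-++ xs ys)
  countTrue-++ (false ∷ xs) ys = countTrue-++ xs ys

  countTrue-concatMap : ∀ {m} (R : Fin m → List Bool) → countTrue (concatMap R (allFin m)) ≡ sum (λ i → countTrue (R i))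
  countTrue-concatMap R = go R (λ i → i)
    where
    go : ∀ {m} {X : Set} (R : X → List Bool) (f : Fin m → X) →
         countTrue (concatMap R (List.tabulate f)) ≡ sum (λ i → countTrue (R (f i)))
    go {zero}  R f = refl
    go {suc m} R f = ≡.trans (countTrue-++ (R (f Fin.zero)) _) (cong (countTrue (R (f Fin.zero)) +_) (go R (λ i → f (Fin.suc i))))

  countTrue-allTrue : ∀ {m} (F : Fin m → Bool) → (∀ j → F j ≡ true) → countTrue (map F (allFin m)) ≡ m
  countTrue-allTrue {m} F F≡true = ≡.trans (cong countTrue (map-tabulate (λ i → i) F)) (go F F≡true)
    where
    go : ∀ {m} (F : Fin m → Bool) → (∀ j → F j ≡ true) → countTrue (List.tabulate F) ≡ m
    go {zero}  F _ = refl
    go {suc m} F F≡true rewrite F≡true Fin.zero = cong suc (go (λ i → F (Fin.suc i)) (λ i → F≡true (Fin.suc i)))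

  countTrue-allFalse : ∀ {m} (F : Fin m → Bool) → (∀ j → F j ≡ false) → countTrue (map F (allFin m)) ≡ 0
  countTrue-allFalse {m} F F≡false = ≡.trans (cong countTrue (map-tabulate (λ i → i) F)) (go F F≡false)
    where
    go : ∀ {m} (F : Fin m → Bool) → (∀ j → F j ≡ false) → countTrue (List.tabulate F) ≡ 0
    go {zero}  F _ = refl
    go {suc m} F F≡false rewrite F≡false Fin.zero = go (λ i → F (Fin.suc i)) (λ i → F≡false (Fin.suc i))

  ⇔-true⇒≡ : ∀ {x y : Bool} → (x ≡ true) ⇔ (y ≡ true) → x ≡ y
  ⇔-true⇒≡ {false} {false} _ = refl
  ⇔-true⇒≡ {true}  {y}     x⇔y = ≡.sym (Equivalence.to x⇔y refl)
  ⇔-true⇒≡ {false} {true}  x⇔y = Equivalence.from x⇔y refl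

  ginCell : ∀ {n} → (Fin n → Fin n → Bool) → ℕ → Fin n → Fin n → Bool
  ginCell S k i j = if does (toℕ i ℕ.<? k) then (if does (i Fin.≤? j) then S i j else false) else false

  edgeCell : ∀ {n} → (Fin n → Fin n → Bool) → ℕ → Fin n → Fin n → Bool
  edgeCell D k a b = if does (toℕ a ℕ.<? k) then (if does (a Fin.<? b) then D a b else false) else false

  ginRow : ∀ {n} → (Fin n → Fin n → Bool) → ℕ → Fin n → ℕ
  ginRow {n} S k i = countTrue (map (ginCell S k i) (allFin n))

  edgeRow : ∀ {n} → (Fin n → Fin n → Bool) → ℕ → Fin n → ℕ
  edgeRow {n} D k a = countTrue (map (edgeCell D k a) (allFin n))

  mGIN-rows : ∀ {n} k (S : Fin n → Fin n → Bool) → mGIN k S ≡ sum (ginRow S k)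
  mGIN-rows k S = countTrue-concatMap (λ i → map (ginCell S k i) (allFin _))

  mEdges-rows : ∀ {n} k (D : Fin n → Fin n → Bool) → mEdges k D ≡ sum (edgeRow D k)
  mEdges-rows k D = countTrue-concatMap (λ a → map (edgeCell D k a) (allFin _))

  sum-zeros : ∀ {m} (f : Fin m → ℕ) → (∀ i → f i ≡ 0) → sum f ≡ 0
  sum-zeros {zero}  f _    = refl
  sum-zeros {suc m} f f≡0 = cong₂ _+_ (f≡0 Fin.zero) (sum-zeros (λ i → f (Fin.suc i)) (λ i → f≡0 (Fin.suc i)))

  ginRow-zero : ∀ {n} (S : Fin (suc n) → Fin (suc n) → Bool) → (∀ j → S Fin.zero j ≡ true) →
                ∀ k → ginRow S (suc k) Fin.zero ≡ suc n
  ginRow-zero {n} S S₀≡true k = countTrue-allTrue (ginCell S (suc k) Fin.zero) cell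
    where
    cell : ∀ j → ginCell S (suc k) Fin.zero j ≡ true
    cell j rewrite dec-true (toℕ (Fin.zero {n}) ℕ.<? suc k) (s≤s z≤n) | dec-true (Fin.zero {n} Fin.≤? j) z≤n = S₀≡true j

  mGIN-1≡n : ∀ {n} (S : Fin (suc n) → Fin (suc n) → Bool) → (∀ j → S Fin.zero j ≡ true) → mGIN 1 S ≡ suc n
  mGIN-1≡n {n} S S₀≡true = begin
    mGIN 1 S                                         ≡⟨ mGIN-rows 1 S ⟩
    ginRow S 1 Fin.zero + sum (λ i → ginRow S 1 (Fin.suc i)) ≡⟨ cong₂ _+_ (ginRow-zero S S₀≡true 0) (sum-zeros _ row≡0) ⟩
    suc n + 0                                        ≡⟨ +-identityʳ (suc n) ⟩
    suc n                                            ∎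
    where
    open ≡.≡-Reasoning
    row≡0 : ∀ i → ginRow S 1 (Fin.suc i) ≡ 0
    row≡0 i = countTrue-allFalse _ λ j →
      cong (λ x → if x then (if does (Fin.suc i Fin.≤? j) then S (Fin.suc i) j else false) else false)
           (dec-false (toℕ (Fin.suc i) ℕ.<? 1) λ { (s≤s ()) })

  -- An edge {i, b} of Δˢ with i < b comes from x_{i+1} x_b ∈ GIN; the other
  -- orientation would need i + 1 ≤ b ≤ i.
  deltaEdge⇔gin : ∀ {n} (S : Fin (suc n) → Fin (suc n) → Bool) (i : Fin n) (b : Fin (suc n)) → toℕ i < toℕ b →
                  DeltaEdge S (inject₁ i) b ⇔ (S (Fin.suc i) b ≡ true)
  deltaEdge⇔gin S i b i<b = mk⇔ to from
    where
    to : DeltaEdge S (inject₁ i) b → S (Fin.suc i) b ≡ true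
    to (i′ , j , 1≤i′ , i′≤j , Si′j , inj₁ (i′-1≡i , j≡b)) =
      ≡.subst₂ (λ x y → S x y ≡ true) i′≡suc-i (toℕ-injective j≡b) Si′j
      where
      i′≡suc-i : i′ ≡ Fin.suc i
      i′≡suc-i = toℕ-injective (≡.trans (suc-pred (toℕ i′) 1≤i′) (cong suc (≡.trans i′-1≡i (toℕ-inject₁ i))))
        where
        suc-pred : ∀ x → 1 ≤ x → x ≡ suc (x ∸ 1)
        suc-pred (suc x) _ = refl
    to (i′ , j , 1≤i′ , i′≤j , Si′j , inj₂ (i′-1≡b , j≡i)) = ⊥-elim (<-irrefl refl b<b)
      where
      b<b : toℕ b < toℕ b
      b<b = ≤-trans (s≤s (≤-trans (≤-reflexive (≡.sym i′-1≡b)) (m∸n≤m (toℕ i′) 1)))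
                    (≤-trans (s≤s i′≤j) (≤-trans (s≤s (≤-reflexive (≡.trans j≡i (toℕ-inject₁ i)))) i<b))
    from : S (Fin.suc i) b ≡ true → DeltaEdge S (inject₁ i) b
    from S≡true = Fin.suc i , b , s≤s z≤n , i<b , S≡true , inj₁ (≡.sym (toℕ-inject₁ i) , refl)

  edgeCell≡ginCell : ∀ {n} (S D : Fin (suc n) → Fin (suc n) → Bool) → RepresentsDelta S D →
                     ∀ k (i : Fin n) b → edgeCell D k (inject₁ i) b ≡ ginCell S (suc k) (Fin.suc i) b
  edgeCell≡ginCell S D rep k i b
    rewrite does-⇔ (mk⇔ (λ i<k → s≤s (≡.subst (_< k) (toℕ-inject₁ i) i<k))
                        (λ { (s≤s i<k) → ≡.subst (_< k) (≡.sym (toℕ-inject₁ i)) i<k }))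
                   (toℕ (inject₁ i) ℕ.<? k) (toℕ (Fin.suc i) ℕ.<? suc k)
          | does-⇔ (mk⇔ (≡.subst (λ x → suc x ≤ toℕ b) (toℕ-inject₁ i))
                        (≡.subst (λ x → suc x ≤ toℕ b) (≡.sym (toℕ-inject₁ i))))
                   (inject₁ i Fin.<? b) (Fin.suc i Fin.≤? b)
    = cong (λ x → if does (toℕ (Fin.suc i) ℕ.<? suc k) then x else false)
           (if-does-cong (Fin.suc i Fin.≤? b) λ i<b →
             ⇔-true⇒≡ (⇔-trans (rep (inject₁ i) b (≡.subst (_< toℕ b) (≡.sym (toℕ-inject₁ i)) i<b))
                               (deltaEdge⇔gin S i b i<b)))
    where
    if-does-cong : ∀ {A : Set} (A? : Dec A) {x y : Bool} → (A → x ≡ y) →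
                   (if does A? then x else false) ≡ (if does A? then y else false)
    if-does-cong (yes a) x≡y = x≡y a
    if-does-cong (no _)  _   = refl

  mEdges+n≡mGIN : ∀ {n} (S D : Fin (suc n) → Fin (suc n) → Bool) → (∀ j → S Fin.zero j ≡ true) → RepresentsDelta S D →
                  ∀ k → k ≤ n → mEdges k D + suc n ≡ mGIN (suc k) S
  mEdges+n≡mGIN {n} S D S₀≡true rep k k≤n = begin
    mEdges k D + suc n
      ≡⟨ cong (_+ suc n) (≡.trans (mEdges-rows k D) (sum-init-last (edgeRow D k))) ⟩
    (sum (λ i → edgeRow D k (inject₁ i)) + edgeRow D k (fromℕ n)) + suc n
      ≡⟨ cong (λ r → (sum (λ i → edgeRow D k (inject₁ i)) + r) + suc n) lastRow≡0 ⟩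
    (sum (λ i → edgeRow D k (inject₁ i)) + 0) + suc n
      ≡⟨ ≡.trans (cong (_+ suc n) (+-identityʳ _)) (+-comm _ (suc n)) ⟩
    suc n + sum (λ i → edgeRow D k (inject₁ i))
      ≡⟨ cong₂ _+_ (≡.sym (ginRow-zero S S₀≡true k))
                   (sum-cong-≗ λ i → cong countTrue (map-cong (edgeCell≡ginCell S D rep k i) (allFin _))) ⟩
    sum (ginRow S (suc k))
      ≡⟨ ≡.sym (mGIN-rows (suc k) S) ⟩
    mGIN (suc k) S ∎
    where
    open ≡.≡-Reasoning
    lastRow≡0 : edgeRow D k (fromℕ n) ≡ 0
    lastRow≡0 = countTrue-allFalse _ λ b →
      cong (λ x → if x then (if does (fromℕ n Fin.<? b) then D (fromℕ n) b else false) else false)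
      (dec-false (toℕ (fromℕ n) ℕ.<? k) λ n<k → <-irrefl refl (<-≤-trans (≡.subst (_< k) (toℕ-fromℕ n) n<k) k≤n))

open Counting

open import Data.Nat using (_+_; _*_; _∸_)
open import Function.Bundles using (Equivalence)

lemma1p7 : ∀ {c ℓ : Level} (K : Field c ℓ) → CharZero K →
    (n : ℕ) (G : Graph n) →
    Σ (List (Poly K (n * n))) λ U → NonemptyOpen K {n} U ×
      (∀ (g : Matrix K n) → InOpen K U g →
        ∀ (S : Fin n → Fin n → Bool) → RepresentsGIN K g G S →
          (mGIN 1 S ≡ n) ×
          (∀ (D : Fin n → Fin n → Bool) → RepresentsDelta S D →
            ∀ (k : ℕ) → 1 ≤ k → k ≤ n ∸ 1 → mEdges k D + n ≡ mGIN (suc k) S))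
lemma1p7 K char0 zero    G = oneP K ∷ [] , GenericMatrices.oneP-nonempty K , λ _ _ _ _ → ≡.refl , λ _ _ _ _ _ → ≡.refl
lemma1p7 K char0 (suc n) G = genericity n ∷ [] , genericity-nonempty n , λ g g∈U S S-gin →
  mGIN-1≡n S (x₁-row g g∈U S S-gin) ,
  λ D D-Δ k _ k≤n → mEdges+n≡mGIN S D (x₁-row g g∈U S S-gin) D-Δ k k≤n
  where
  open GenericMatrices K
  open InitialIdeal K char0
  x₁-row : ∀ g → InOpen K (genericity n ∷ []) g → ∀ S → RepresentsGIN K g G S → ∀ j → S Fin.zero j ≡ true
  x₁-row g g∈U S S-gin j = Equivalence.from (S-gin Fin.zero j z≤n) (x₁xⱼ∉initial g (inOpen⇒generic g g∈U) G j)
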